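{- Let $\Delta\ge 4$ be an integer. If $G$ is a $\Delta$-special graph on $n$ vertices, then \[ i(G)= \left(1-\frac{\Delta}{\lfloor \Delta^2/4\rfloor+\Delta}\right)(n-1)+1.\]
   Context: All graphs are finite and simple. An independent dominating set of a graph is a set $S$ of pairwise non-adjacent vertices such that every vertex not in $S$ has a neighbor in $S$; $i(G)$ denotes the minimum size of an independent dominating set of $G$. For an integer $\Delta\ge4$, a connected graph $G$ is called $\Delta$-special if: (1) every vertex that belongs to some cycle of $G$ has degree $\Delta$; (2) every edge has at least one end that belongs to some cycle; (3) each component of the subgraph induced by the set of all vertices that belong to cycles is isomorphic to $K_{\lceil \Delta/2\rceil+1}$, or to $K_{\lfloor \Delta/2\rfloor+1}$, or (only when $\Delta=4$) to an odd cycle. -}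

module Defs where

open import Data.Nat using (ℕ; zero; suc; _+_; _*_; _∸_; _≤_; _≡ᵇ_; ⌊_/2⌋; ⌈_/2⌉)
open import Data.Nat.DivMod using (_%_; _/_)
open import Data.Bool using (Bool; true; false)
open import Data.Fin using (Fin; toℕ)
open import Data.Fin.Subset using (Subset; _∈_; _∉_; ∣_∣)
open import Data.Vec using (tabulate)
open import Data.Product using (Σ; ∃; ∃-syntax; _×_; _,_)
open import Data.Sum using (_⊎_)
open import Function using (_⇔_)
open import Function.Definitions using (Injective)
open import Relation.Binary.PropositionalEquality using (_≡_; _≢_)
open import Relation.Nullary using (¬_)
open import Data.Unit using (⊤)

record Graph (n : ℕ) : Set where
  field
    adj   : Fin n → Fin n → Bool
    sym   : ∀ u v → adj u v ≡ adj v u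
    irrefl : ∀ v → adj v v ≡ false
open Graph public

module _ {n : ℕ} (G : Graph n) where

  Adj : Fin n → Fin n → Set
  Adj u v = adj G u v ≡ true

  deg : Fin n → ℕ
  deg v = ∣ tabulate (adj G v) ∣

  data ReachIn (P : Fin n → Set) : Fin n → Fin n → Set where
    here : ∀ {u} → P u → ReachIn P u u
    step : ∀ {u w v} → P u → Adj u w → ReachIn P w v → ReachIn P u v

  Everything : Fin n → Set
  Everything _ = ⊤

  Connected : Set
  Connected = Fin n × (∀ u v → ReachIn Everything u v)

  CycNext : (k : ℕ) → Fin (3 + k) → Fin (3 + k) → Set
  CycNext k i j = toℕ j ≡ (suc (toℕ i)) % (3 + k)

  OnCycle : Fin n → Set
  OnCycle v = ∃[ k ] Σ (Fin (3 + k) → Fin n) λ c →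
    Injective _≡_ _≡_ c × (∀ i j → CycNext k i j → Adj (c i) (c j)) × (∃[ i ] c i ≡ v)

  -- the component of the subgraph induced by cycle vertices containing v
  InComp : Fin n → Fin n → Set
  InComp v u = ReachIn OnCycle v u

  -- the component of v (a cycle vertex) is isomorphic to K_m:
  -- an injective enumeration by Fin m of exactly that component, pairwise adjacent
  CompIsComplete : Fin n → ℕ → Set
  CompIsComplete v m = Σ (Fin m → Fin n) λ f →
    Injective _≡_ _≡_ f × (∀ u → InComp v u ⇔ (∃[ i ] f i ≡ u)) ×
    (∀ i j → i ≢ j → Adj (f i) (f j))

  CompIsOddCycle : Fin n → Set
  CompIsOddCycle v = ∃[ k ] Σ (Fin (3 + 2 * k) → Fin n) λ f →
    Injective _≡_ _≡_ f × (∀ u → InComp v u ⇔ (∃[ i ] f i ≡ u)) ×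
    (∀ i j → Adj (f i) (f j) ⇔ (CycNext (2 * k) i j ⊎ CycNext (2 * k) j i))

  Special : ℕ → Set
  Special Δ = Connected
    × (∀ v → OnCycle v → deg v ≡ Δ)
    × (∀ u v → Adj u v → OnCycle u ⊎ OnCycle v)
    × (∀ v → OnCycle v →
         CompIsComplete v (⌈ Δ /2⌉ + 1) ⊎ CompIsComplete v (⌊ Δ /2⌋ + 1)
         ⊎ (Δ ≡ 4 × CompIsOddCycle v))

  Independent : Subset n → Set
  Independent S = ∀ u v → u ∈ S → v ∈ S → ¬ Adj u v

  Dominating : Subset n → Set
  Dominating S = ∀ v → v ∉ S → ∃[ u ] (u ∈ S × Adj u v)

  IndepDom : Subset n → Set
  IndepDom S = Independent S × Dominating S

  IsIndepDomNumber : ℕ → Set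
  IsIndepDomNumber k = (∃[ S ] (IndepDom S × ∣ S ∣ ≡ k)) × (∀ S → IndepDom S → k ≤ ∣ S ∣)

{-# OPTIONS --safe #-}
module Submission where

-- Call the vertices on no cycle links. Links are pairwise non-adjacent, and the components of
-- the cycle vertices (cliques K_{q+1} with q ∈ {⌈Δ/2⌉, ⌊Δ/2⌋}, or odd cycles when Δ = 4) hang
-- together through the links like the blocks of a tree. Root G at a cycle vertex r. Each
-- component has a unique vertex closest to r, its top, and each link has exactly one neighbour
-- closer to r. S₀ takes, in every component, an independent dominating set of the component that
-- avoids the top (one vertex of a clique, k + 1 vertices of C_{2k+3}), together with all links
-- that have no chosen neighbour. Counting the edges between components and links shows that each
-- component contributes as much to D·(|S₀| − 1) as to Q·(n − 1), where
-- Q = ⌊Δ²/4⌋ = q(Δ − q) and D = Q + Δ. For an arbitrary independent dominating set S, every link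
-- outside S has a neighbour in S and S meets a component in at most as many vertices as S₀ does;
-- the same edge count, weighted by the number of link neighbours, gives |S₀| ≤ |S|.

open import Defs hiding (sym)
open import Data.Nat using (ℕ; zero; suc; _+_; _*_; _∸_; _≤_; _<_; z≤n; s≤s; ⌊_/2⌋; ⌈_/2⌉)
open import Data.Nat.Induction using (<-wellFounded)
open import Induction.WellFounded using (Acc; acc)
open import Data.Nat.DivMod using (_%_; _/_; m<n⇒m%n≡m; n%n≡0; m%n<n; m*n/n≡m; +-distrib-/-∣ʳ)
open import Data.Nat.Divisibility using (divides)
import Data.Nat.Properties as ℕ
open import Algebra.Properties.Semiring.Sum ℕ.+-*-semiring
  using (sum; sum-cong-≗; ∑-distrib-+; ∑-comm; *-distribˡ-sum; *-distribʳ-sum; sum-replicate-zero)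
open import Data.Fin using (Fin)
import Data.Fin as Fin
import Data.Fin.Properties as Fin
open import Data.Fin.Subset using (Subset; _∈_; ∣_∣; inside; outside; ⊤)
import Data.Fin.Subset.Properties as Subset
open import Data.Vec using (Vec; _∷_; []; tabulate; lookup; _[_]=_)
import Data.Vec.Relation.Unary.Any as Any
open import Data.Vec.Membership.Propositional using () renaming (_∈_ to _∈ᵥ_; _∉_ to _∉ᵥ_)
open import Data.Vec.Membership.Propositional.Properties using (∈-lookup)
import Data.Vec.Properties as Vec
open import Data.Product using (Σ; ∃; ∃₂; ∃-syntax; _×_; _,_; proj₁; proj₂; swap)
open import Data.Sum using (_⊎_; inj₁; inj₂; [_,_]′)
open import Data.Empty using (⊥-elim; ⊥-elim-irr)
open import Function using (_∘_; _⇔_; mk⇔; Equivalence)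
open import Function.Definitions using (Injective)
open import Data.Bool using (Bool; true; false; not; _xor_)
import Data.Bool.Properties as Bool
import Function.Properties.Equivalence as ⇔
open import Relation.Binary.PropositionalEquality
  using (_≡_; _≢_; refl; sym; trans; cong; cong₂; subst; subst₂; module ≡-Reasoning)
open import Relation.Nullary using (¬_; Dec; yes; no; does; contradiction)
open import Relation.Nullary.Decidable using (_×-dec_; _⊎-dec_; _→-dec_; ¬?; ¬¬-excluded-middle; decidable-stable)
open import Data.Nat.Tactic.RingSolver using (solve-∀)
open import Relation.Unary using (Pred; Decidable)
open import Relation.Binary.Definitions using (tri<; tri≈; tri>)
open import Level using (0ℓ)

𝟙 : ∀ {p} {P : Set p} → Dec P → ℕ
𝟙 (yes _) = 1
𝟙 (no _)  = 0

module _ {p} {P : Set p} where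

  𝟙-yes : (d : Dec P) → P → 𝟙 d ≡ 1
  𝟙-yes (yes _) _ = refl
  𝟙-yes (no ¬p) p = contradiction p ¬p

  𝟙-no : (d : Dec P) → ¬ P → 𝟙 d ≡ 0
  𝟙-no (yes p) ¬p = contradiction p ¬p
  𝟙-no (no _)  _  = refl

  𝟙≤1 : (d : Dec P) → 𝟙 d ≤ 1
  𝟙≤1 (yes _) = s≤s z≤n
  𝟙≤1 (no _)  = z≤n

  𝟙¬-cases : ∀ {x} (d : Dec P) → (P → x ≡ 0) → (¬ P → x ≡ 1) → x ≡ 𝟙 (¬? d)
  𝟙¬-cases (yes p) if-p _     = if-p p
  𝟙¬-cases (no ¬p) _    if-¬p = if-¬p ¬p

  𝟙+𝟙¬≡1 : (d : Dec P) → 𝟙 d + 𝟙 (¬? d) ≡ 1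
  𝟙+𝟙¬≡1 (yes _) = refl
  𝟙+𝟙¬≡1 (no _)  = refl

module _ {p q} {P : Set p} {Q : Set q} where

  𝟙-cong : (d : Dec P) (e : Dec Q) → P ⇔ Q → 𝟙 d ≡ 𝟙 e
  𝟙-cong (yes _) (yes _) _   = refl
  𝟙-cong (yes p) (no ¬q) p⇔q = contradiction (Equivalence.to p⇔q p) ¬q
  𝟙-cong (no ¬p) (yes q) p⇔q = contradiction (Equivalence.from p⇔q q) ¬p
  𝟙-cong (no _)  (no _)  _   = refl

  𝟙-× : (d : Dec P) (e : Dec Q) → 𝟙 (d ×-dec e) ≡ 𝟙 d * 𝟙 e
  𝟙-× (yes _) (yes _) = refl
  𝟙-× (yes _) (no _)  = refl
  𝟙-× (no _)  (yes _) = refl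
  𝟙-× (no _)  (no _)  = refl

  𝟙-⊎ : (d : Dec P) (e : Dec Q) → (P → ¬ Q) → 𝟙 (d ⊎-dec e) ≡ 𝟙 d + 𝟙 e
  𝟙-⊎ (yes p) (yes q) p⇒¬q = contradiction q (p⇒¬q p)
  𝟙-⊎ (yes _) (no _)  _    = refl
  𝟙-⊎ (no _)  (yes _) _    = refl
  𝟙-⊎ (no _)  (no _)  _    = refl

  𝟙+𝟙≤1 : (d : Dec P) (e : Dec Q) → (P → ¬ Q) → 𝟙 d + 𝟙 e ≤ 1
  𝟙+𝟙≤1 d e p⇒¬q = subst (_≤ 1) (𝟙-⊎ d e p⇒¬q) (𝟙≤1 (d ⊎-dec e))

  𝟙*-absorb : (d : Dec P) (e : Dec Q) → (Q → P) → 𝟙 d * 𝟙 e ≡ 𝟙 e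
  𝟙*-absorb d (no _)  _   = ℕ.*-zeroʳ (𝟙 d)
  𝟙*-absorb d (yes q) q⇒p = cong (_* 1) (𝟙-yes d (q⇒p q))

  𝟙-split : (d : Dec P) (e : Dec Q) → 𝟙 d ≡ 𝟙 (d ×-dec e) + 𝟙 (d ×-dec ¬? e)
  𝟙-split (yes _) (yes _) = refl
  𝟙-split (yes _) (no _)  = refl
  𝟙-split (no _)  (yes _) = refl
  𝟙-split (no _)  (no _)  = refl

𝟙-swap : ∀ {p q} {P : Set p} {Q : Set q} (d : Dec P) (e : Dec Q) → 𝟙 (d ×-dec e) ≡ 𝟙 (e ×-dec d)
𝟙-swap d e = 𝟙-cong (d ×-dec e) (e ×-dec d) (mk⇔ swap swap)

sum-mono-≤ : ∀ {n} {f g : Fin n → ℕ} → (∀ i → f i ≤ g i) → sum f ≤ sum g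
sum-mono-≤ {zero}  f≤g = z≤n
sum-mono-≤ {suc n} f≤g = ℕ.+-mono-≤ (f≤g Fin.zero) (sum-mono-≤ (f≤g ∘ Fin.suc))

sum-≗0 : ∀ {n} (f : Fin n → ℕ) → (∀ i → f i ≡ 0) → sum f ≡ 0
sum-≗0 {n} f f≗0 = trans (sum-cong-≗ f≗0) (sum-replicate-zero n)

sum-const : ∀ n c → sum {n} (λ _ → c) ≡ n * c
sum-const zero    c = refl
sum-const (suc n) c = cong (c +_) (sum-const n c)

sum-single : ∀ {n} (f : Fin n → ℕ) (x : Fin n) → (∀ i → i ≢ x → f i ≡ 0) → sum f ≡ f x
sum-single f Fin.zero    vanish = trans (cong (f Fin.zero +_) (sum-≗0 (f ∘ Fin.suc) (λ i → vanish (Fin.suc i) λ ()))) (ℕ.+-identityʳ _)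
sum-single f (Fin.suc x) vanish =
  cong₂ _+_ (vanish Fin.zero λ ()) (sum-single (f ∘ Fin.suc) x (λ i i≢x → vanish (Fin.suc i) (i≢x ∘ Fin.suc-injective)))

sum-linear : ∀ {n} a b (f g : Fin n → ℕ) → sum (λ i → a * f i + b * g i) ≡ a * sum f + b * sum g
sum-linear a b f g = trans (∑-distrib-+ (λ i → a * f i) (λ i → b * g i))
                           (sym (cong₂ _+_ (*-distribˡ-sum a f) (*-distribˡ-sum b g)))

term≤sum : ∀ {n} (f : Fin n → ℕ) x → f x ≤ sum f
term≤sum f Fin.zero    = ℕ.m≤m+n _ _
term≤sum f (Fin.suc x) = ℕ.≤-trans (term≤sum (f ∘ Fin.suc) x) (ℕ.m≤n+m _ _)

module _ {n p} {P : Pred (Fin n) p} (P? : Decidable P) where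

  sum-𝟙-unique : (∀ {u v} → P u → P v → u ≡ v) → sum (λ v → 𝟙 (P? v)) ≡ 𝟙 (Fin.any? P?)
  sum-𝟙-unique unique with Fin.any? P?
  ... | yes (x , px) = trans (sum-single (λ v → 𝟙 (P? v)) x (λ v v≢x → 𝟙-no (P? v) (λ pv → v≢x (unique pv px)))) (𝟙-yes (P? x) px)
  ... | no ¬∃       = sum-≗0 (λ v → 𝟙 (P? v)) (λ v → 𝟙-no (P? v) (λ pv → ¬∃ (v , pv)))

  sum-𝟙-unique-witness : ∀ {x} → P x → (∀ {v} → P v → v ≡ x) → sum (λ v → 𝟙 (P? v)) ≡ 1
  sum-𝟙-unique-witness {x} px unique =
    trans (sum-𝟙-unique (λ {u} {v} pu pv → trans (unique {u} pu) (sym (unique {v} pv)))) (𝟙-yes (Fin.any? P?) (x , px))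

1+sum-𝟙-≢ : ∀ {m} (x : Fin m) → 1 + sum (λ i → 𝟙 (¬? (i Fin.≟ x))) ≡ m
1+sum-𝟙-≢ {m} x = begin
  1 + sum (λ i → 𝟙 (¬? (i Fin.≟ x)))                          ≡⟨ cong (_+ sum (λ i → 𝟙 (¬? (i Fin.≟ x)))) (sym (sum-𝟙-unique-witness (Fin._≟ x) refl (λ e → e))) ⟩
  sum (λ i → 𝟙 (i Fin.≟ x)) + sum (λ i → 𝟙 (¬? (i Fin.≟ x))) ≡⟨ sym (∑-distrib-+ (λ i → 𝟙 (i Fin.≟ x)) (λ i → 𝟙 (¬? (i Fin.≟ x)))) ⟩
  sum (λ i → 𝟙 (i Fin.≟ x) + 𝟙 (¬? (i Fin.≟ x)))              ≡⟨ sum-cong-≗ (λ i → 𝟙+𝟙¬≡1 (i Fin.≟ x)) ⟩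
  sum {m} (λ _ → 1)                                           ≡⟨ trans (sum-const m 1) (ℕ.*-identityʳ m) ⟩
  m                                                           ∎
  where open ≡-Reasoning

module _ {m n} {f : Fin m → Fin n} (f-inj : Injective _≡_ _≡_ f) where

  inImage? : Decidable (λ v → ∃ λ i → f i ≡ v)
  inImage? v = Fin.any? (λ i → f i Fin.≟ v)

  sum-image : (h : Fin n → ℕ) → sum (λ v → 𝟙 (inImage? v) * h v) ≡ sum (h ∘ f)
  sum-image h = sym (begin
    sum (h ∘ f)                                         ≡⟨ sum-cong-≗ {n = m} (λ i → sym (pick i)) ⟩
    sum (λ i → sum (λ v → 𝟙 (f i Fin.≟ v) * h v))       ≡⟨ ∑-comm (λ i v → 𝟙 (f i Fin.≟ v) * h v) ⟩
    sum (λ v → sum (λ i → 𝟙 (f i Fin.≟ v) * h v))       ≡⟨ sum-cong-≗ (λ v → sym (*-distribʳ-sum (h v) (λ i → 𝟙 (f i Fin.≟ v)))) ⟩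
    sum (λ v → sum (λ i → 𝟙 (f i Fin.≟ v)) * h v)       ≡⟨ sum-cong-≗ (λ v → cong (_* h v) (sum-𝟙-unique (λ i → f i Fin.≟ v) (λ p q → f-inj (trans p (sym q))))) ⟩
    sum (λ v → 𝟙 (inImage? v) * h v)                    ∎)
    where
    open ≡-Reasoning
    pick : ∀ i → sum (λ v → 𝟙 (f i Fin.≟ v) * h v) ≡ h (f i)
    pick i = trans (sum-single (λ v → 𝟙 (f i Fin.≟ v) * h v) (f i) (λ v v≢fi → cong (_* h v) (𝟙-no (f i Fin.≟ v) (v≢fi ∘ sym))))
                   (trans (cong (_* h (f i)) (𝟙-yes (f i Fin.≟ f i) refl)) (ℕ.*-identityˡ (h (f i))))

∣∣≡sum𝟙∈ : ∀ {n} (S : Subset n) → ∣ S ∣ ≡ sum (λ v → 𝟙 (v Subset.∈? S))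
∣∣≡sum𝟙∈ []            = refl
∣∣≡sum𝟙∈ (inside ∷ S)  = cong suc (trans (∣∣≡sum𝟙∈ S) (sum-cong-≗ (λ v → 𝟙-cong (v Subset.∈? S) (Fin.suc v Subset.∈? (inside ∷ S)) (mk⇔ _[_]=_.there Subset.drop-there))))
∣∣≡sum𝟙∈ (outside ∷ S) = trans (∣∣≡sum𝟙∈ S) (sum-cong-≗ (λ v → 𝟙-cong (v Subset.∈? S) (Fin.suc v Subset.∈? (outside ∷ S)) (mk⇔ _[_]=_.there Subset.drop-there)))

∈-tabulate : ∀ {n} (b : Fin n → Bool) {v} → v ∈ tabulate b ⇔ b v ≡ true
∈-tabulate b {v} = mk⇔ (λ v∈ → trans (sym (Vec.lookup∘tabulate b v)) (Vec.[]=⇒lookup v∈))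
                       (λ bv → Vec.lookup⇒[]= v (tabulate b) (trans (Vec.lookup∘tabulate b v) bv))

does⇔ : ∀ {p} {P : Set p} (d : Dec P) → does d ≡ true ⇔ P
does⇔ (yes p) = mk⇔ (λ _ → p) (λ _ → refl)
does⇔ (no ¬p) = mk⇔ (λ ()) (λ p → contradiction p ¬p)

module _ {n p} {P : Pred (Fin n) p} (P? : Decidable P) where

  fromDec : Subset n
  fromDec = tabulate (does ∘ P?)

  ∈-fromDec : ∀ {v} → v ∈ fromDec ⇔ P v
  ∈-fromDec {v} = ⇔.trans (∈-tabulate (does ∘ P?)) (does⇔ (P? v))

  ∣fromDec∣ : ∣ fromDec ∣ ≡ sum (λ v → 𝟙 (P? v))
  ∣fromDec∣ = trans (∣∣≡sum𝟙∈ fromDec) (sum-cong-≗ (λ v → 𝟙-cong (v Subset.∈? fromDec) (P? v) ∈-fromDec))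

another : ∀ {m} → 2 ≤ m → (i : Fin m) → ∃ λ j → j ≢ i
another {suc (suc _)} _ i = Fin.punchIn i Fin.zero , Fin.punchInᵢ≢i i Fin.zero
another {suc zero} (s≤s ()) _

module CyclicOrder (M : ℕ) where

  Next : Fin (suc M) → Fin (suc M) → Set
  Next i j = Fin.toℕ j ≡ suc (Fin.toℕ i) % suc M

  next? : ∀ i j → Dec (Next i j)
  next? i j = Fin.toℕ j ℕ.≟ suc (Fin.toℕ i) % suc M

  next-cases : ∀ {i j} → Next i j → (Fin.toℕ j ≡ suc (Fin.toℕ i)) ⊎ (suc (Fin.toℕ i) ≡ suc M × Fin.toℕ j ≡ 0)
  next-cases {i} e with suc (Fin.toℕ i) ℕ.<? suc M
  ... | yes 1+i<1+M = inj₁ (trans e (m<n⇒m%n≡m 1+i<1+M))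
  ... | no  1+i≮1+M = inj₂ (last , trans e (trans (cong (_% suc M) last) (n%n≡0 (suc M))))
    where
    last : suc (Fin.toℕ i) ≡ suc M
    last = ℕ.≤-antisym (Fin.toℕ<n i) (ℕ.≮⇒≥ 1+i≮1+M)

  next-intro : ∀ {i j} → Fin.toℕ j ≡ suc (Fin.toℕ i) → Next i j
  next-intro {i} {j} j≡1+i = trans j≡1+i (sym (m<n⇒m%n≡m (subst (_< suc M) j≡1+i (Fin.toℕ<n j))))

  next-wrap : ∀ {i j} → suc (Fin.toℕ i) ≡ suc M → Fin.toℕ j ≡ 0 → Next i j
  next-wrap {i} last j≡0 = trans j≡0 (sym (trans (cong (_% suc M) last) (n%n≡0 (suc M))))

  next-functional : ∀ {i j j′} → Next i j → Next i j′ → j ≡ j′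
  next-functional e e′ = Fin.toℕ-injective (trans e (sym e′))

  next-injective : ∀ {i i′ j} → Next i j → Next i′ j → i ≡ i′
  next-injective e e′ with next-cases e | next-cases e′
  ... | inj₁ x       | inj₁ y       = Fin.toℕ-injective (ℕ.suc-injective (trans (sym x) y))
  ... | inj₁ x       | inj₂ (_ , y) with () ← trans (sym x) y
  ... | inj₂ (_ , x) | inj₁ y       with () ← trans (sym y) x
  ... | inj₂ (x , _) | inj₂ (y , _) = Fin.toℕ-injective (ℕ.suc-injective (trans x (sym y)))

  next-asym : 2 ≤ M → ∀ {i j} → Next i j → ¬ Next j i
  next-asym 2≤M {i} {j} e e′ = ℕ.<⇒≱ 2≤M (M≤1 (next-cases e) (next-cases e′))
    where
    M≡ : ∀ {x} → suc x ≡ suc M → M ≡ x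
    M≡ last = sym (ℕ.suc-injective last)
    M≤1 : _ → _ → M ≤ 1
    M≤1 (inj₁ j≡1+i)        (inj₁ i≡1+j)       = ⊥-elim (ℕ.<-irrefl (trans i≡1+j (cong suc j≡1+i)) (s≤s (ℕ.n≤1+n _)))
    M≤1 (inj₁ j≡1+i)        (inj₂ (last , i≡0)) = ℕ.≤-reflexive (trans (M≡ last) (trans j≡1+i (cong suc i≡0)))
    M≤1 (inj₂ (last , j≡0)) (inj₁ i≡1+j)       = ℕ.≤-reflexive (trans (M≡ last) (trans i≡1+j (cong suc j≡0)))
    M≤1 (inj₂ (last , _))   (inj₂ (_ , i≡0))    = ℕ.≤-trans (ℕ.≤-reflexive (trans (M≡ last) i≡0)) z≤n

  succ : Fin (suc M) → Fin (suc M)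
  succ i = Fin.fromℕ< (m%n<n (suc (Fin.toℕ i)) (suc M))

  next-succ : ∀ i → Next i (succ i)
  next-succ i = Fin.toℕ-fromℕ< (m%n<n (suc (Fin.toℕ i)) (suc M))

  succ-injective : Injective _≡_ _≡_ succ
  succ-injective {i} {j} si≡sj = next-injective (next-succ i) (subst (Next j) (sym si≡sj) (next-succ j))

  pred : ∀ j → ∃ λ i → Next i j
  pred Fin.zero    = Fin.fromℕ M , next-wrap (cong suc (Fin.toℕ-fromℕ M)) refl
  pred (Fin.suc j) = Fin.inject₁ j , next-intro (cong suc (sym (Fin.toℕ-inject₁ j)))

  sum-succ : ∀ h → sum (h ∘ succ) ≡ sum h
  sum-succ h = trans (sym (sum-image succ-injective h)) (sum-cong-≗ (λ v → trans (cong (_* h v) (𝟙-yes (inImage? succ-injective v) (onto v))) (ℕ.*-identityˡ (h v))))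
    where
    onto : ∀ v → ∃ λ i → succ i ≡ v
    onto v = let i , e = pred v in i , next-functional (next-succ i) e

  sum-𝟙-next-or-prev : 2 ≤ M → ∀ i → sum (λ j → 𝟙 (next? i j ⊎-dec next? j i)) ≡ 2
  sum-𝟙-next-or-prev 2≤M i = begin
    sum (λ j → 𝟙 (next? i j ⊎-dec next? j i))          ≡⟨ sum-cong-≗ (λ j → 𝟙-⊎ (next? i j) (next? j i) (next-asym 2≤M)) ⟩
    sum (λ j → 𝟙 (next? i j) + 𝟙 (next? j i))           ≡⟨ ∑-distrib-+ (λ j → 𝟙 (next? i j)) (λ j → 𝟙 (next? j i)) ⟩
    sum (λ j → 𝟙 (next? i j)) + sum (λ j → 𝟙 (next? j i)) ≡⟨ cong₂ _+_ (sum-𝟙-unique-witness (next? i) (next-succ i) (λ e → next-functional e (next-succ i)))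
                                                                     (sum-𝟙-unique-witness (λ j → next? j i) (proj₂ (pred i)) (λ e → next-injective e (proj₂ (pred i)))) ⟩
    2                                                     ∎
    where open ≡-Reasoning

odd : ℕ → Bool
odd zero    = false
odd (suc n) = not (odd n)

odd-2* : ∀ k → odd (2 * k) ≡ false
odd-2* zero    = refl
odd-2* (suc k) = begin
  odd (2 * suc k)         ≡⟨ cong odd (ℕ.*-suc 2 k) ⟩
  not (not (odd (2 * k))) ≡⟨ Bool.not-involutive _ ⟩
  odd (2 * k)             ≡⟨ odd-2* k ⟩
  false                   ∎
  where open ≡-Reasoning

𝟙-not : ∀ b → 𝟙 (b Bool.≟ true) + 𝟙 (not b Bool.≟ true) ≡ 1
𝟙-not true  = refl
𝟙-not false = refl

sum-alternating : ∀ {m} p (h : ℕ → ℕ) → m ≡ p + p → (∀ x → h x + h (suc x) ≡ 1) → sum {m} (h ∘ Fin.toℕ) ≡ p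
sum-alternating {zero}        zero    h _ _   = refl
sum-alternating {suc (suc m)} (suc p) h e alt = begin
  h 0 + (h 1 + sum {m} (h ∘ suc ∘ suc ∘ Fin.toℕ)) ≡⟨ sym (ℕ.+-assoc (h 0) (h 1) _) ⟩
  (h 0 + h 1) + sum {m} (h ∘ suc ∘ suc ∘ Fin.toℕ) ≡⟨ cong₂ _+_ (alt 0) (sum-alternating p (h ∘ suc ∘ suc) m≡p+p (alt ∘ suc ∘ suc)) ⟩
  suc p                                           ∎
  where
  open ≡-Reasoning
  m≡p+p : m ≡ p + p
  m≡p+p = ℕ.suc-injective (trans (ℕ.suc-injective e) (ℕ.+-suc p p))
sum-alternating {zero}        (suc p) h () _
sum-alternating {suc zero}    zero    h () _
sum-alternating {suc zero}    (suc p) h e  _ = contradiction (sym (ℕ.suc-injective e)) (ℕ.m+1+n≢0 p)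
sum-alternating {suc (suc m)} zero    h () _

half-bound : ∀ s k → s + s ≤ 3 + 2 * k → s ≤ suc k
half-bound s k 2s≤ with s ℕ.≤? suc k
... | yes s≤1+k = s≤1+k
... | no  s≰1+k = contradiction 2s≤ (ℕ.<⇒≱ (ℕ.<-≤-trans (ℕ.≤-reflexive (double k)) (ℕ.+-mono-≤ 2+k≤s 2+k≤s)))
  where
  2+k≤s : 2 + k ≤ s
  2+k≤s = ℕ.≰⇒> s≰1+k
  double : ∀ k → suc (3 + 2 * k) ≡ (2 + k) + (2 + k)
  double = solve-∀

⌊n/2⌋*⌈n/2⌉≡n*n/4 : ∀ n → ⌊ n /2⌋ * ⌈ n /2⌉ ≡ n * n / 4
⌊n/2⌋*⌈n/2⌉≡n*n/4 zero          = refl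
⌊n/2⌋*⌈n/2⌉≡n*n/4 (suc zero)    = refl
⌊n/2⌋*⌈n/2⌉≡n*n/4 (suc (suc d)) = begin
  suc ⌊ d /2⌋ * suc ⌈ d /2⌉            ≡⟨ expand ⌊ d /2⌋ ⌈ d /2⌉ ⟩
  ⌊ d /2⌋ * ⌈ d /2⌉ + suc (⌊ d /2⌋ + ⌈ d /2⌉) ≡⟨ cong₂ (λ x y → x + suc y) (⌊n/2⌋*⌈n/2⌉≡n*n/4 d) (ℕ.⌊n/2⌋+⌈n/2⌉≡n d) ⟩
  d * d / 4 + suc d                    ≡⟨ cong (d * d / 4 +_) (sym (m*n/n≡m (suc d) 4)) ⟩
  d * d / 4 + suc d * 4 / 4            ≡⟨ sym (+-distrib-/-∣ʳ (d * d) (divides (suc d) refl)) ⟩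
  (d * d + suc d * 4) / 4              ≡⟨ cong (_/ 4) (square d) ⟩
  suc (suc d) * suc (suc d) / 4        ∎
  where
  open ≡-Reasoning
  expand : ∀ x y → suc x * suc y ≡ x * y + suc (x + y)
  expand = solve-∀
  square : ∀ x → x * x + suc x * 4 ≡ suc (suc x) * suc (suc x)
  square = solve-∀

module _ {Δ q : ℕ} where

  half*rest≡Δ*Δ/4 : q ≡ ⌈ Δ /2⌉ ⊎ q ≡ ⌊ Δ /2⌋ → q * (Δ ∸ q) ≡ Δ * Δ / 4
  half*rest≡Δ*Δ/4 (inj₁ refl) = begin
    ⌈ Δ /2⌉ * (Δ ∸ ⌈ Δ /2⌉)                   ≡⟨ cong (λ x → ⌈ Δ /2⌉ * (x ∸ ⌈ Δ /2⌉)) (sym (ℕ.⌊n/2⌋+⌈n/2⌉≡n Δ)) ⟩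
    ⌈ Δ /2⌉ * (⌊ Δ /2⌋ + ⌈ Δ /2⌉ ∸ ⌈ Δ /2⌉)   ≡⟨ cong (⌈ Δ /2⌉ *_) (ℕ.m+n∸n≡m ⌊ Δ /2⌋ ⌈ Δ /2⌉) ⟩
    ⌈ Δ /2⌉ * ⌊ Δ /2⌋                         ≡⟨ ℕ.*-comm ⌈ Δ /2⌉ ⌊ Δ /2⌋ ⟩
    ⌊ Δ /2⌋ * ⌈ Δ /2⌉                         ≡⟨ ⌊n/2⌋*⌈n/2⌉≡n*n/4 Δ ⟩
    Δ * Δ / 4                                 ∎
    where open ≡-Reasoning
  half*rest≡Δ*Δ/4 (inj₂ refl) = begin
    ⌊ Δ /2⌋ * (Δ ∸ ⌊ Δ /2⌋)                   ≡⟨ cong (λ x → ⌊ Δ /2⌋ * (x ∸ ⌊ Δ /2⌋)) (sym (ℕ.⌊n/2⌋+⌈n/2⌉≡n Δ)) ⟩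
    ⌊ Δ /2⌋ * (⌊ Δ /2⌋ + ⌈ Δ /2⌉ ∸ ⌊ Δ /2⌋)   ≡⟨ cong (⌊ Δ /2⌋ *_) (ℕ.m+n∸m≡n ⌊ Δ /2⌋ ⌈ Δ /2⌉) ⟩
    ⌊ Δ /2⌋ * ⌈ Δ /2⌉                         ≡⟨ ⌊n/2⌋*⌈n/2⌉≡n*n/4 Δ ⟩
    Δ * Δ / 4                                 ∎
    where open ≡-Reasoning

  2≤half : q ≡ ⌈ Δ /2⌉ ⊎ q ≡ ⌊ Δ /2⌋ → 4 ≤ Δ → 2 ≤ q
  2≤half q-half 4≤Δ = [ (λ { refl → ℕ.≤-trans 2≤⌊Δ/2⌋ (ℕ.⌊n/2⌋≤⌈n/2⌉ Δ) }) , (λ { refl → 2≤⌊Δ/2⌋ }) ]′ q-half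
    where
    2≤⌊Δ/2⌋ : 2 ≤ ⌊ Δ /2⌋
    2≤⌊Δ/2⌋ = ℕ.⌊n/2⌋-mono 4≤Δ

  half<Δ : q ≡ ⌈ Δ /2⌉ ⊎ q ≡ ⌊ Δ /2⌋ → 4 ≤ Δ → q < Δ
  half<Δ q-half 4≤Δ = ℕ.≤-<-trans q≤⌈Δ/2⌉ (⌈n/2⌉<n′ 4≤Δ)
    where
    q≤⌈Δ/2⌉ : q ≤ ⌈ Δ /2⌉
    q≤⌈Δ/2⌉ = [ ℕ.≤-reflexive , (λ { refl → ℕ.⌊n/2⌋≤⌈n/2⌉ Δ }) ]′ q-half
    ⌈n/2⌉<n′ : ∀ {Δ} → 4 ≤ Δ → ⌈ Δ /2⌉ < Δ
    ⌈n/2⌉<n′ {suc (suc d)} _ = ℕ.⌈n/2⌉<n d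
    ⌈n/2⌉<n′ {suc zero} (s≤s ())

-- The contribution of one component to  D · (|S₀| − 1) = Q · (n − 1),  with its subtractions moved across.
Balanced : (D Q size count ext : ℕ) → Set
Balanced D Q size count ext = D * (count + size * ext) + Q ≡ D * (1 + count * ext) + Q * (size + size * ext)

clique-balanced : ∀ q e → Balanced (q * e + (q + e)) (q * e) (q + 1) 1 e
clique-balanced q e = identity q e
  where
  identity : ∀ q e → (q * e + (q + e)) * (1 + (q + 1) * e) + q * e ≡ (q * e + (q + e)) * (1 + 1 * e) + q * e * ((q + 1) + (q + 1) * e)
  identity = solve-∀

oddCycle-balanced : ∀ k → Balanced 8 4 (3 + 2 * k) (suc k) 2
oddCycle-balanced k = identity k
  where
  identity : ∀ k → 8 * (suc k + (3 + 2 * k) * 2) + 4 ≡ 8 * (1 + suc k * 2) + 4 * ((3 + 2 * k) + (3 + 2 * k) * 2)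
  identity = solve-∀

component-≤ : ∀ {count s e} → s ≤ count → 1 ≤ e → count + s * e ≤ count * e + s
component-≤ {s = s} {suc e} s≤count _ with ℕ.m≤n⇒∃[o]m+o≡n s≤count
... | d , refl = begin
  (s + d) + s * suc e        ≡⟨ left s d e ⟩
  (s + s * suc e) + d        ≤⟨ ℕ.+-monoʳ-≤ (s + s * suc e) (ℕ.m≤m*n d (suc e)) ⟩
  (s + s * suc e) + d * suc e ≡⟨ right s d e ⟩
  (s + d) * suc e + s        ∎
  where
  open ℕ.≤-Reasoning
  left : ∀ s d e → (s + d) + s * suc e ≡ (s + s * suc e) + d
  left = solve-∀
  right : ∀ s d e → (s + s * suc e) + d * suc e ≡ (s + d) * suc e + s
  right = solve-∀

-- Summing the balances of all components: P picked vertices, L = ∑ linkDeg, T tops, X = ∑ linkDeg over picked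
-- vertices, C cycle vertices, U vertices with a lower link, W links, S = |S₀|.
balance-sum : ∀ D Q {P L T X C U W S m} → D * (P + L) + Q * T ≡ D * (T + X) + Q * (C + L) →
              L ≡ U + W → T ≡ 1 + U → S + X ≡ P + W → C + W ≡ suc m → D * S ≡ Q * m + D
balance-sum D Q {P} {X = X} {C} {U} {W} {S} {m} sums refl refl S+X≡P+W C+W≡1+m =
  ℕ.+-cancelʳ-≡ (D * X + Q) _ _ (begin
    D * S + (D * X + Q)              ≡⟨ expand-S D Q S X ⟩
    D * (S + X) + Q                  ≡⟨ cong (λ y → D * y + Q) S+X≡P+W ⟩
    D * (P + W) + Q                  ≡⟨ ℕ.+-cancelʳ-≡ (D * U + Q * U) _ _ (trans (sym (expand-L D Q P U W)) (trans sums (expand-R D Q X C U W))) ⟩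
    D * (1 + X) + Q * (C + W)        ≡⟨ cong (λ y → D * (1 + X) + Q * y) C+W≡1+m ⟩
    D * (1 + X) + Q * suc m          ≡⟨ expand-m D Q X m ⟩
    Q * m + D + (D * X + Q)          ∎)
  where
  open ≡-Reasoning
  expand-S : ∀ D Q S X → D * S + (D * X + Q) ≡ D * (S + X) + Q
  expand-S = solve-∀
  expand-L : ∀ D Q P U W → D * (P + (U + W)) + Q * (1 + U) ≡ D * (P + W) + Q + (D * U + Q * U)
  expand-L = solve-∀
  expand-R : ∀ D Q X C U W → D * ((1 + U) + X) + Q * (C + (U + W)) ≡ D * (1 + X) + Q * (C + W) + (D * U + Q * U)
  expand-R = solve-∀
  expand-m : ∀ D Q X m → D * (1 + X) + Q * suc m ≡ Q * m + D + (D * X + Q)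
  expand-m = solve-∀

module OddCycleChoice (k : ℕ) where
  open CyclicOrder (2 + 2 * k) public

  -- With the top at position c of the cycle 0, 1, …, 2k+2, choose the non-zero positions whose parity differs from that of c.
  pick : ℕ → ℕ → Bool
  pick c zero    = false
  pick c (suc x) = not (odd x) xor odd c

  pick-self : ∀ c → pick c c ≡ false
  pick-self zero    = refl
  pick-self (suc c) = Bool.xor-same (not (odd c))

  pick-flip : ∀ c y → pick c (suc (suc y)) ≡ not (pick c (suc y))
  pick-flip c y = sym (Bool.not-distribˡ-xor (not (odd y)) (odd c))

  pick-step : ∀ c x → pick c x ≡ true → pick c (suc x) ≡ false
  pick-step c (suc y) p = trans (pick-flip c y) (cong not p)

  pick-twice-false : ∀ c x → pick c x ≡ false → pick c (suc x) ≡ false → x ≡ 0 × odd c ≡ true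
  pick-twice-false c zero    _ p1 with odd c
  ... | true = refl , refl
  pick-twice-false c (suc y) p0 p1 with () ← trans (sym p1) (trans (pick-flip c y) (cong not p0))

  pick-last : ∀ c → pick c (2 + 2 * k) ≡ odd c
  pick-last c = cong (λ b → not (not b) xor odd c) (odd-2* k)

  pick-penultimate : ∀ c → pick c (2 + 2 * k) ≡ false → pick c (1 + 2 * k) ≡ true
  pick-penultimate c p = trans (cong (λ b → not b xor odd c) (odd-2* k)) (cong not (trans (sym (pick-last c)) p))

  chosen : Fin (3 + 2 * k) → Fin (3 + 2 * k) → Bool
  chosen c i = pick (Fin.toℕ c) (Fin.toℕ i)

  chosen-self : ∀ c → chosen c c ≡ false
  chosen-self c = pick-self (Fin.toℕ c)

  chosen-independent : ∀ c {i j} → chosen c i ≡ true → chosen c j ≡ true → ¬ Next i j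
  chosen-independent c {i} {j} ci cj e with next-cases {i} {j} e
  ... | inj₁ j≡1+i with () ← trans (sym cj) (trans (cong (pick (Fin.toℕ c)) j≡1+i) (pick-step (Fin.toℕ c) (Fin.toℕ i) ci))
  ... | inj₂ (_ , j≡0) with () ← trans (sym cj) (cong (pick (Fin.toℕ c)) j≡0)

  chosen-dominating : ∀ c i → chosen c i ≡ false → ∃ λ j → chosen c j ≡ true × (Next i j ⊎ Next j i)
  chosen-dominating c i ci with suc (Fin.toℕ i) ℕ.<? 3 + 2 * k
  ... | no  i-not-last = Fin.fromℕ< 1+2k<L , penultimate-chosen , inj₂ (next-intro {Fin.fromℕ< 1+2k<L} {i} (trans i≡last (cong suc (sym (Fin.toℕ-fromℕ< 1+2k<L)))))
    where
    1+2k<L : 1 + 2 * k < 3 + 2 * k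
    1+2k<L = s≤s (ℕ.n≤1+n _)
    i≡last : Fin.toℕ i ≡ 2 + 2 * k
    i≡last = ℕ.≤-antisym (ℕ.≤-pred (Fin.toℕ<n i)) (ℕ.≤-pred (ℕ.≮⇒≥ i-not-last))
    penultimate-chosen : chosen c (Fin.fromℕ< 1+2k<L) ≡ true
    penultimate-chosen = trans (cong (pick (Fin.toℕ c)) (Fin.toℕ-fromℕ< 1+2k<L))
                               (pick-penultimate (Fin.toℕ c) (trans (cong (pick (Fin.toℕ c)) (sym i≡last)) ci))
  ... | yes 1+i<L with pick (Fin.toℕ c) (suc (Fin.toℕ i)) in next-pick
  ...   | true  = Fin.fromℕ< 1+i<L , trans (cong (pick (Fin.toℕ c)) (Fin.toℕ-fromℕ< 1+i<L)) next-pick ,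
                  inj₁ (next-intro {i} {Fin.fromℕ< 1+i<L} (Fin.toℕ-fromℕ< 1+i<L))
  ...   | false with pick-twice-false (Fin.toℕ c) (Fin.toℕ i) ci next-pick
  ...     | i≡0 , oc≡true = Fin.fromℕ (2 + 2 * k) , trans (cong (pick (Fin.toℕ c)) (Fin.toℕ-fromℕ (2 + 2 * k))) (trans (pick-last (Fin.toℕ c)) oc≡true) ,
                            inj₂ (next-wrap {Fin.fromℕ (2 + 2 * k)} {i} (cong suc (Fin.toℕ-fromℕ (2 + 2 * k))) i≡0)

  ∑chosen : ∀ c → sum (λ i → 𝟙 (chosen c i Bool.≟ true)) ≡ suc k
  ∑chosen c = sum-alternating (suc k) (λ x → 𝟙 (pick (Fin.toℕ c) (suc x) Bool.≟ true)) (2+2k≡ k) alternates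
    where
    2+2k≡ : ∀ k → 2 + 2 * k ≡ suc k + suc k
    2+2k≡ = solve-∀
    alternates : ∀ x → 𝟙 (pick (Fin.toℕ c) (suc x) Bool.≟ true) + 𝟙 (pick (Fin.toℕ c) (suc (suc x)) Bool.≟ true) ≡ 1
    alternates x rewrite pick-flip (Fin.toℕ c) x = 𝟙-not (pick (Fin.toℕ c) (suc x))

  independent-≤ : ∀ {p} {S : Pred (Fin (3 + 2 * k)) p} (S? : Decidable S) →
                  (∀ {i j} → S i → S j → ¬ Next i j) → sum (λ i → 𝟙 (S? i)) ≤ suc k
  independent-≤ {S = S} S? independent = half-bound (sum h) k (begin
    sum h + sum h                 ≡⟨ cong (sum h +_) (sym (sum-succ h)) ⟩
    sum h + sum (h ∘ succ)        ≡⟨ sym (∑-distrib-+ h (h ∘ succ)) ⟩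
    sum (λ i → h i + h (succ i))  ≤⟨ sum-mono-≤ (λ i → 𝟙+𝟙≤1 (S? i) (S? (succ i)) (λ si ssi → independent si ssi (next-succ i))) ⟩
    sum {3 + 2 * k} (λ _ → 1)     ≡⟨ trans (sum-const (3 + 2 * k) 1) (ℕ.*-identityʳ _) ⟩
    3 + 2 * k                     ∎)
    where
    open ℕ.≤-Reasoning
    h : Fin (3 + 2 * k) → ℕ
    h i = 𝟙 (S? i)

module GraphBasics {n} (G : Graph n) where

  Adj? : ∀ u v → Dec (Adj G u v)
  Adj? u v = adj G u v Bool.≟ true

  adj-sym : ∀ {u v} → Adj G u v → Adj G v u
  adj-sym {u} {v} uv = trans (Graph.sym G v u) uv

  adj⇒≢ : ∀ {u v} → Adj G u v → u ≢ v
  adj⇒≢ {u} uu refl with () ← trans (sym uu) (Graph.irrefl G u)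

  deg≡sum𝟙 : ∀ v → deg G v ≡ sum (λ u → 𝟙 (Adj? v u))
  deg≡sum𝟙 v = trans (∣∣≡sum𝟙∈ (tabulate (adj G v)))
                     (sum-cong-≗ (λ u → 𝟙-cong (u Subset.∈? tabulate (adj G v)) (Adj? v u) (∈-tabulate (adj G v))))

  module _ {P : Pred (Fin n) 0ℓ} where

    reach-source : ∀ {u v} → ReachIn G P u v → P u
    reach-source (here pu)     = pu
    reach-source (step pu _ _) = pu

    reach-target : ∀ {u v} → ReachIn G P u v → P v
    reach-target (here pv)    = pv
    reach-target (step _ _ r) = reach-target r

    reach-trans : ∀ {u v w} → ReachIn G P u v → ReachIn G P v w → ReachIn G P u w
    reach-trans (here _)       r′ = r′
    reach-trans (step pu uw r) r′ = step pu uw (reach-trans r r′)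

    reach-edge : ∀ {u v} → P u → P v → Adj G u v → ReachIn G P u v
    reach-edge pu pv uv = step pu uv (here pv)

    reach-sym : ∀ {u v} → ReachIn G P u v → ReachIn G P v u
    reach-sym (here pu)      = here pu
    reach-sym (step pu uw r) = reach-trans (reach-sym r) (reach-edge (reach-source r) pu (adj-sym uw))

  reach-map : ∀ {P Q : Pred (Fin n) 0ℓ} → (∀ {x} → P x → Q x) → ∀ {u v} → ReachIn G P u v → ReachIn G Q u v
  reach-map P⇒Q (here pu)      = here (P⇒Q pu)
  reach-map P⇒Q (step pu uw r) = step (P⇒Q pu) uw (reach-map P⇒Q r)

module Cycles {n} (G : Graph n) where
  open GraphBasics G
  open import Data.Vec.Membership.DecPropositional (Fin._≟_ {n}) using () renaming (_∈?_ to _∈ᵥ?_)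

  data SimplePath (P : Pred (Fin n) 0ℓ) : (m : ℕ) → Fin n → Fin n → Vec (Fin n) (suc m) → Set where
    [_]  : ∀ {v} → P v → SimplePath P 0 v v (v ∷ [])
    _∷⟨_⟩_∣_ : ∀ {m u w v} {xs : Vec (Fin n) (suc m)} → P u → Adj G u w → SimplePath P m w v xs →
               u ∉ᵥ xs → SimplePath P (suc m) u v (u ∷ xs)

  module _ {P : Pred (Fin n) 0ℓ} where

    suffix : ∀ {m u v x xs} → SimplePath P m u v xs → x ∈ᵥ xs → ∃₂ λ m′ ys → SimplePath P m′ x v ys
    suffix p@([ _ ])          (Any.here refl) = _ , _ , p
    suffix p@(_ ∷⟨ _ ⟩ _ ∣ _) (Any.here refl) = _ , _ , p
    suffix (_ ∷⟨ _ ⟩ p ∣ _)   (Any.there x∈)  = suffix p x∈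

    loop-erase : ∀ {u v} → ReachIn G P u v → ∃₂ λ m xs → SimplePath P m u v xs
    loop-erase (here pu) = _ , _ , [ pu ]
    loop-erase {u} (step pu uw r) with loop-erase r
    ... | m , xs , p with u ∈ᵥ? xs
    ...   | yes u∈ = suffix p u∈
    ...   | no u∉  = _ , _ , pu ∷⟨ uw ⟩ p ∣ u∉

    path-head : ∀ {m u v xs} → SimplePath P m u v xs → lookup xs Fin.zero ≡ u
    path-head [ _ ]          = refl
    path-head (_ ∷⟨ _ ⟩ _ ∣ _) = refl

    path-last : ∀ {m u v xs} → SimplePath P m u v xs → ∀ i → Fin.toℕ i ≡ m → lookup xs i ≡ v
    path-last [ _ ]            Fin.zero    _ = refl
    path-last (_ ∷⟨ _ ⟩ p ∣ _) (Fin.suc i) e = path-last p i (ℕ.suc-injective e)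

    path-inside : ∀ {m u v xs} → SimplePath P m u v xs → ∀ i → P (lookup xs i)
    path-inside [ pv ]            Fin.zero    = pv
    path-inside (pu ∷⟨ _ ⟩ _ ∣ _) Fin.zero    = pu
    path-inside (_ ∷⟨ _ ⟩ p ∣ _)  (Fin.suc i) = path-inside p i

    path-injective : ∀ {m u v xs} → SimplePath P m u v xs → Injective _≡_ _≡_ (lookup xs)
    path-injective [ _ ] {Fin.zero} {Fin.zero} _ = refl
    path-injective (_ ∷⟨ _ ⟩ _ ∣ _) {Fin.zero} {Fin.zero} _ = refl
    path-injective {xs = _ ∷ xs} (_ ∷⟨ _ ⟩ _ ∣ u∉) {Fin.zero} {Fin.suc j} e = contradiction (subst (_∈ᵥ xs) (sym e) (∈-lookup j xs)) u∉
    path-injective {xs = _ ∷ xs} (_ ∷⟨ _ ⟩ _ ∣ u∉) {Fin.suc i} {Fin.zero} e = contradiction (subst (_∈ᵥ xs) e (∈-lookup i xs)) u∉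
    path-injective (_ ∷⟨ _ ⟩ p ∣ _) {Fin.suc i} {Fin.suc j} e = cong Fin.suc (path-injective p e)

    path-adj : ∀ {m u v xs} → SimplePath P m u v xs → ∀ i j → Fin.toℕ j ≡ suc (Fin.toℕ i) → Adj G (lookup xs i) (lookup xs j)
    path-adj (_ ∷⟨ uw ⟩ p ∣ _) Fin.zero    (Fin.suc Fin.zero) _ = subst (Adj G _) (sym (path-head p)) uw
    path-adj (_ ∷⟨ _ ⟩ p ∣ _)  (Fin.suc i) (Fin.suc j)        e = path-adj p i j (ℕ.suc-injective e)
    path-adj [ _ ]             Fin.zero    Fin.zero           ()
    path-adj (_ ∷⟨ _ ⟩ _ ∣ _)  Fin.zero    Fin.zero           ()
    path-adj (_ ∷⟨ _ ⟩ _ ∣ _)  Fin.zero    (Fin.suc (Fin.suc _)) ()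
    path-adj (_ ∷⟨ _ ⟩ _ ∣ _)  (Fin.suc _) Fin.zero           ()

  detour⇒onCycle : ∀ {w u₁ u₂} → Adj G w u₁ → Adj G w u₂ → u₁ ≢ u₂ → ReachIn G (_≢ w) u₁ u₂ → OnCycle G w
  detour⇒onCycle {w} {u₁} {u₂} wu₁ wu₂ u₁≢u₂ r with loop-erase r
  ... | zero  , _ , [ _ ] = contradiction refl u₁≢u₂
  ... | suc k , xs , p    = k , c , c-injective , c-adj , Fin.zero , refl
    where
    c : Fin (3 + k) → Fin n
    c = lookup (w ∷ xs)
    c-injective : Injective _≡_ _≡_ c
    c-injective {Fin.zero}  {Fin.zero}  _ = refl
    c-injective {Fin.zero}  {Fin.suc j} e = contradiction (sym e) (path-inside p j)
    c-injective {Fin.suc i} {Fin.zero}  e = contradiction e (path-inside p i)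
    c-injective {Fin.suc i} {Fin.suc j} e = cong Fin.suc (path-injective p e)
    step-adj : ∀ i j → Fin.toℕ j ≡ suc (Fin.toℕ i) → Adj G (c i) (c j)
    step-adj Fin.zero    (Fin.suc Fin.zero)    _ = subst (Adj G w) (sym (path-head p)) wu₁
    step-adj (Fin.suc i) (Fin.suc j)           e = path-adj p i j (ℕ.suc-injective e)
    step-adj Fin.zero    Fin.zero              ()
    step-adj Fin.zero    (Fin.suc (Fin.suc _)) ()
    step-adj (Fin.suc _) Fin.zero              ()
    closing-adj : ∀ i j → suc (Fin.toℕ i) ≡ 3 + k → Fin.toℕ j ≡ 0 → Adj G (c i) (c j)
    closing-adj (Fin.suc i) Fin.zero    last _ =
      subst (λ x → Adj G x w) (sym (path-last p i (ℕ.suc-injective (ℕ.suc-injective last)))) (adj-sym wu₂)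
    closing-adj Fin.zero    _           ()   _
    closing-adj (Fin.suc _) (Fin.suc _) _    ()
    c-adj : ∀ i j → CycNext G k i j → Adj G (c i) (c j)
    c-adj i j e with CyclicOrder.next-cases (2 + k) {i} {j} e
    ... | inj₁ j≡1+i          = step-adj i j j≡1+i
    ... | inj₂ (i-last , j≡0) = closing-adj i j i-last j≡0

module _ {q} {Q : Pred ℕ q} (Q? : Decidable Q) where

  least-witness : ∀ {k} → Q k → ∃ λ m → Q m × (∀ {j} → Q j → m ≤ j)
  least-witness {k} = go (<-wellFounded k)
    where
    go : ∀ {k} → Acc _<_ k → Q k → ∃ λ m → Q m × (∀ {j} → Q j → m ≤ j)
    go {k} (acc smaller) qk with ℕ.anyUpTo? Q? k
    ... | yes (j , j<k , qj) = go (smaller j<k) qj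
    ... | no  none-below     = k , qk , λ qj → ℕ.≮⇒≥ (λ j<k → none-below (_ , j<k , qj))

module Distance {n} (G : Graph n) (r : Fin n) (connected : ∀ v → ReachIn G (Everything G) v r) where
  open GraphBasics G

  WalkOfLength : ℕ → Fin n → Fin n → Set
  WalkOfLength zero    u v = u ≡ v
  WalkOfLength (suc k) u v = ∃ λ w → Adj G u w × WalkOfLength k w v

  walkOfLength? : ∀ k u v → Dec (WalkOfLength k u v)
  walkOfLength? zero    u v = u Fin.≟ v
  walkOfLength? (suc k) u v = Fin.any? (λ w → Adj? u w ×-dec walkOfLength? k w v)

  reach⇒walk : ∀ {P u v} → ReachIn G P u v → ∃ λ k → WalkOfLength k u v
  reach⇒walk (here _)       = 0 , refl
  reach⇒walk (step _ uw r) with reach⇒walk r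
  ... | k , walk = suc k , _ , uw , walk

  abstract
    shortest : ∀ v → ∃ λ k → WalkOfLength k v r × (∀ {j} → WalkOfLength j v r → k ≤ j)
    shortest v = least-witness (λ k → walkOfLength? k v r) (proj₂ (reach⇒walk (connected v)))

  dist : Fin n → ℕ
  dist v = proj₁ (shortest v)

  dist-walk : ∀ v → WalkOfLength (dist v) v r
  dist-walk v = proj₁ (proj₂ (shortest v))

  dist-minimal : ∀ {v k} → WalkOfLength k v r → dist v ≤ k
  dist-minimal {v} = proj₂ (proj₂ (shortest v))

  dist-root : dist r ≡ 0
  dist-root = ℕ.n≤0⇒n≡0 (dist-minimal {r} {0} refl)

  dist≡0⇒root : ∀ {v} → dist v ≡ 0 → v ≡ r
  dist≡0⇒root {v} d≡0 = subst (λ k → WalkOfLength k v r) d≡0 (dist-walk v)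

  dist-adj : ∀ {u v} → Adj G u v → dist u ≤ suc (dist v)
  dist-adj {u} {v} uv = dist-minimal {u} {suc (dist v)} (v , uv , dist-walk v)

  parent : ∀ {v} → v ≢ r → ∃ λ u → Adj G v u × suc (dist u) ≡ dist v
  parent {v} v≢r with dist v | dist-walk v | dist-adj {v}
  ... | zero  | v≡r            | _      = contradiction v≡r v≢r
  ... | suc d | u , vu , walk  | ≤1+du = u , vu , ℕ.≤-antisym (s≤s (dist-minimal walk)) (≤1+du vu)

  descent : ∀ v → ReachIn G (λ x → x ≡ v ⊎ dist x < dist v) v r
  descent v = go (dist v) refl
    where
    go : ∀ d {v} → dist v ≡ d → ReachIn G (λ x → x ≡ v ⊎ dist x < dist v) v r
    go zero    {v} d≡0 = subst (ReachIn G _ v) (dist≡0⇒root d≡0) (here (inj₁ refl))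
    go (suc d) {v} d≡1+d with parent {v} (λ { refl → ℕ.1+n≢0 (trans (sym d≡1+d) dist-root) })
    ... | u , vu , du<dv = step (inj₁ refl) vu (reach-map lower (go d (ℕ.suc-injective (trans du<dv d≡1+d))))
      where
      lower : ∀ {x} → x ≡ u ⊎ dist x < dist u → x ≡ v ⊎ dist x < dist v
      lower (inj₁ refl) = inj₂ (ℕ.≤-reflexive du<dv)
      lower (inj₂ lt)   = inj₂ (ℕ.<-trans lt (ℕ.≤-reflexive du<dv))

  descent-avoiding : ∀ {u w} → u ≢ w → dist u ≤ dist w → ReachIn G (_≢ w) u r
  descent-avoiding {u} {w} u≢w du≤dw = reach-map avoids (descent u)
    where
    avoids : ∀ {x} → x ≡ u ⊎ dist x < dist u → x ≢ w
    avoids (inj₁ refl) = u≢w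
    avoids (inj₂ lt) refl = ℕ.<⇒≱ lt du≤dw

module SpecialGraph {n} (Δ : ℕ) (4≤Δ : 4 ≤ Δ) (G : Graph n) (special : Special G Δ)
                    (cyc? : Decidable (OnCycle G)) (r : Fin n) (r-cyc : OnCycle G r) where
  open GraphBasics G
  open Cycles G using (detour⇒onCycle)

  Cyc : Pred (Fin n) 0ℓ
  Cyc = OnCycle G

  Link : Pred (Fin n) 0ℓ
  Link v = ¬ Cyc v

  connected : ∀ u v → ReachIn G (Everything G) u v
  connected = proj₂ (proj₁ special)

  deg-cyc : ∀ v → Cyc v → deg G v ≡ Δ
  deg-cyc = proj₁ (proj₂ special)

  edge-cyc : ∀ u v → Adj G u v → Cyc u ⊎ Cyc v
  edge-cyc = proj₁ (proj₂ (proj₂ special))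

  open Distance G r (λ v → connected v r) public

  links-independent : ∀ {u v} → Link u → Link v → ¬ Adj G u v
  links-independent lu lv uv = [ lu , lv ]′ (edge-cyc _ _ uv)

  link-nbr-cyc : ∀ {w u} → Link w → Adj G w u → Cyc u
  link-nbr-cyc {u = u} lw wu with cyc? u
  ... | yes cu = cu
  ... | no  lu = contradiction wu (links-independent lw lu)

  link≢root : ∀ {w} → Link w → w ≢ r
  link≢root lw refl = lw r-cyc

  avoid-link : ∀ {w} → Link w → ∀ {x} → Cyc x → x ≢ w
  avoid-link lw cx refl = lw cx

  inComp-refl : ∀ {v} → Cyc v → InComp G v v
  inComp-refl = here

  inComp-edge : ∀ {u v} → Cyc u → Cyc v → Adj G u v → InComp G u v
  inComp-edge = reach-edge

  inComp-cyc : ∀ {u v} → InComp G u v → Cyc v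
  inComp-cyc = reach-target

  record Enumeration (v : Fin n) : Set where
    field
      size      : ℕ
      vertex    : Fin size → Fin n
      injective : Injective _≡_ _≡_ vertex
      complete  : ∀ {u} → InComp G v u → ∃ λ i → vertex i ≡ u
      in-comp   : ∀ i → InComp G v (vertex i)

  enumeration : ∀ {v m} (f : Fin m → Fin n) → Injective _≡_ _≡_ f → (∀ u → InComp G v u ⇔ (∃ λ i → f i ≡ u)) → Enumeration v
  enumeration f f-inj f-onto = record
    { size = _ ; vertex = f ; injective = f-inj
    ; complete = λ {u} → Equivalence.to (f-onto u) ; in-comp = λ i → Equivalence.from (f-onto (f i)) (i , refl) }

  data Shape (v : Fin n) : Set where
    clique    : ∀ q → q ≡ ⌈ Δ /2⌉ ⊎ q ≡ ⌊ Δ /2⌋ → CompIsComplete G v (q + 1) → Shape v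
    oddCycle  : Δ ≡ 4 → CompIsOddCycle G v → Shape v

  shape : ∀ v → Cyc v → Shape v
  shape v cv with proj₂ (proj₂ (proj₂ special)) v cv
  ... | inj₁ K          = clique _ (inj₁ refl) K
  ... | inj₂ (inj₁ K)   = clique _ (inj₂ refl) K
  ... | inj₂ (inj₂ (Δ≡4 , C)) = oddCycle Δ≡4 C

  shape-enumeration : ∀ {v} → Shape v → Enumeration v
  shape-enumeration (clique _ _ (f , f-inj , f-onto , _))       = enumeration f f-inj f-onto
  shape-enumeration (oddCycle _ (_ , f , f-inj , f-onto , _))   = enumeration f f-inj f-onto

  enumeration-inComp? : ∀ {v} → Enumeration v → ∀ u → Dec (InComp G v u)
  enumeration-inComp? {v} E u with inImage? (Enumeration.injective E) u
  ... | yes (i , fi≡u) = yes (subst (InComp G v) fi≡u (Enumeration.in-comp E i))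
  ... | no  u∉         = no (u∉ ∘ Enumeration.complete E)

  inComp? : ∀ v u → Dec (InComp G v u)
  inComp? v u with cyc? v
  ... | yes cv = enumeration-inComp? (shape-enumeration (shape v cv)) u
  ... | no  lv = no (lv ∘ reach-source)

  link-separates : ∀ {w u₁ u₂} → Link w → Adj G w u₁ → Adj G w u₂ → ReachIn G (_≢ w) u₁ u₂ → u₁ ≡ u₂
  link-separates {u₁ = u₁} {u₂} lw wu₁ wu₂ walk with u₁ Fin.≟ u₂
  ... | yes u₁≡u₂ = u₁≡u₂
  ... | no  u₁≢u₂ = contradiction (detour⇒onCycle wu₁ wu₂ u₁≢u₂ walk) lw

  via-root : ∀ {w u v} → ReachIn G (_≢ w) u r → ReachIn G (_≢ w) v r → ReachIn G (_≢ w) u v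
  via-root u→r v→r = reach-trans u→r (reach-sym v→r)

  in-comp-avoiding : ∀ {w} → Link w → ∀ {u v} → InComp G u v → ReachIn G (_≢ w) u v
  in-comp-avoiding lw = reach-map (avoid-link lw)

  lower-nbr-dist : ∀ {v w} → Adj G v w → dist w < dist v → suc (dist w) ≡ dist v
  lower-nbr-dist vw dw<dv = ℕ.≤-antisym dw<dv (dist-adj vw)

  HasLowerLink : Pred (Fin n) 0ℓ
  HasLowerLink v = ∃ λ w → Link w × Adj G v w × dist w < dist v

  lower-link-cut : ∀ {v w} → Link w → Adj G v w → dist w < dist v → ¬ ReachIn G (_≢ w) v r
  lower-link-cut {v} {w} lw vw dw<dv v→r with parent (link≢root lw)
  ... | p , wp , dp<dw = ℕ.<-asym dw<dv (ℕ.≤-reflexive (subst (λ x → suc (dist x) ≡ dist w) (sym v≡p) dp<dw))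
    where
    v≡p : v ≡ p
    v≡p = link-separates lw (adj-sym vw) wp (via-root v→r (descent-avoiding (adj⇒≢ (adj-sym wp)) (ℕ.<⇒≤ (ℕ.≤-reflexive dp<dw))))

  link-nbr-dist≢ : ∀ {w u} → Link w → Adj G w u → dist u ≢ dist w
  link-nbr-dist≢ {w} {u} lw wu du≡dw with parent (link≢root lw)
  ... | p , wp , dp<dw = ℕ.<-irrefl (trans (cong dist (sym u≡p)) du≡dw) (ℕ.≤-reflexive dp<dw)
    where
    u≡p : u ≡ p
    u≡p = link-separates lw wu wp (via-root (descent-avoiding (adj⇒≢ (adj-sym wu)) (ℕ.≤-reflexive du≡dw))
                                            (descent-avoiding (adj⇒≢ (adj-sym wp)) (ℕ.<⇒≤ (ℕ.≤-reflexive dp<dw))))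

  link-lower-nbr-unique : ∀ {w u₁ u₂} → Link w → Adj G w u₁ → Adj G w u₂ → dist u₁ < dist w → dist u₂ < dist w → u₁ ≡ u₂
  link-lower-nbr-unique lw wu₁ wu₂ du₁<dw du₂<dw =
    link-separates lw wu₁ wu₂ (via-root (descent-avoiding (adj⇒≢ (adj-sym wu₁)) (ℕ.<⇒≤ du₁<dw))
                                        (descent-avoiding (adj⇒≢ (adj-sym wu₂)) (ℕ.<⇒≤ du₂<dw)))

  lower-link-unique : ∀ {v w₁ w₂} → Adj G v w₁ → Adj G v w₂ → Link w₁ → Link w₂ →
                      dist w₁ < dist v → dist w₂ < dist v → w₁ ≡ w₂
  lower-link-unique {v} {w₁} {w₂} vw₁ vw₂ lw₁ lw₂ dw₁<dv dw₂<dv with w₁ Fin.≟ w₂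
  ... | yes w₁≡w₂ = w₁≡w₂
  ... | no  w₁≢w₂ = contradiction (step (adj⇒≢ vw₁) vw₂ (descent-avoiding (w₁≢w₂ ∘ sym) dw₂≤dw₁)) (lower-link-cut lw₁ vw₁ dw₁<dv)
    where
    dw₂≤dw₁ : dist w₂ ≤ dist w₁
    dw₂≤dw₁ = ℕ.≤-reflexive (ℕ.suc-injective (trans (lower-nbr-dist vw₂ dw₂<dv) (sym (lower-nbr-dist vw₁ dw₁<dv))))

  -- Tops are defined locally; lowest-is-top and top-unique show that they are the vertices closest to r.
  Top : Pred (Fin n) 0ℓ
  Top v = Cyc v × (v ≡ r ⊎ HasLowerLink v)

  hasLowerLink? : Decidable HasLowerLink
  hasLowerLink? v = Fin.any? (λ w → ¬? (cyc? w) ×-dec Adj? v w ×-dec (dist w ℕ.<? dist v))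

  top? : Decidable Top
  top? v = cyc? v ×-dec ((v Fin.≟ r) ⊎-dec hasLowerLink? v)

  lower-links-equal : ∀ {t₁ t₂} → InComp G t₁ t₂ → (l₁ : HasLowerLink t₁) (l₂ : HasLowerLink t₂) →
                      dist (proj₁ l₂) ≤ dist (proj₁ l₁) → t₁ ≡ t₂
  lower-links-equal t₁~t₂ (w₁ , lw₁ , t₁w₁ , d₁) (w₂ , lw₂ , t₂w₂ , d₂) d₂≤d₁ with w₁ Fin.≟ w₂
  ... | yes refl  = link-separates lw₁ (adj-sym t₁w₁) (adj-sym t₂w₂) (in-comp-avoiding lw₁ t₁~t₂)
  ... | no  w₁≢w₂ = contradiction (reach-trans (in-comp-avoiding lw₁ t₁~t₂) t₂→r) (lower-link-cut lw₁ t₁w₁ d₁)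
    where
    t₂→r = step (avoid-link lw₁ (inComp-cyc t₁~t₂)) t₂w₂ (descent-avoiding (w₁≢w₂ ∘ sym) d₂≤d₁)

  top-unique : ∀ {t₁ t₂} → InComp G t₁ t₂ → Top t₁ → Top t₂ → t₁ ≡ t₂
  top-unique t₁~t₂ (_ , inj₁ refl) (_ , inj₁ refl) = refl
  top-unique t₁~t₂ (_ , inj₁ refl) (_ , inj₂ (w , lw , tw , dw<dt)) =
    contradiction (in-comp-avoiding lw (reach-sym t₁~t₂)) (lower-link-cut lw tw dw<dt)
  top-unique t₁~t₂ (_ , inj₂ (w , lw , tw , dw<dt)) (_ , inj₁ refl) =
    contradiction (in-comp-avoiding lw t₁~t₂) (lower-link-cut lw tw dw<dt)
  top-unique t₁~t₂ (_ , inj₂ l₁) (_ , inj₂ l₂) with ℕ.≤-total (dist (proj₁ l₂)) (dist (proj₁ l₁))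
  ... | inj₁ d₂≤d₁ = lower-links-equal t₁~t₂ l₁ l₂ d₂≤d₁
  ... | inj₂ d₁≤d₂ = sym (lower-links-equal (reach-sym t₁~t₂) l₂ l₁ d₁≤d₂)

  lowest-is-top : ∀ {v u} → InComp G v u → (∀ {x} → InComp G v x → dist u ≤ dist x) → Top u
  lowest-is-top {v} {u} v~u lowest with u Fin.≟ r
  ... | yes u≡r = inComp-cyc v~u , inj₁ u≡r
  ... | no  u≢r with parent u≢r
  ...   | p , up , dp<du with cyc? p
  ...     | no  lp = inComp-cyc v~u , inj₂ (p , lp , up , ℕ.≤-reflexive dp<du)
  ...     | yes cp = contradiction (lowest (reach-trans v~u (inComp-edge (inComp-cyc v~u) cp up)))
                                   (ℕ.<⇒≱ (ℕ.≤-reflexive dp<du))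

  top-exists : ∀ {v} → Cyc v → ∃ λ t → Top t × InComp G t v
  top-exists {v} cv with least-witness (λ k → Fin.any? (λ u → inComp? v u ×-dec (dist u ℕ.≟ k))) (v , inComp-refl cv , refl)
  ... | _ , (u , v~u , refl) , lowest = u , lowest-is-top v~u (λ {x} v~x → lowest (x , v~x , refl)) , reach-sym v~u

  ∑-comp : Fin n → (Fin n → ℕ) → ℕ
  ∑-comp t h = sum (λ v → 𝟙 (inComp? t v) * h v)

  ∑-comp-enumeration : ∀ {t} (E : Enumeration t) h → ∑-comp t h ≡ sum (h ∘ Enumeration.vertex E)
  ∑-comp-enumeration {t} E h = trans (sum-cong-≗ (λ v → cong (_* h v) (𝟙-cong (inComp? t v) (inImage? injective v) (mk⇔ complete in-comp′))))
                                     (sum-image injective h)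
    where
    open Enumeration E
    in-comp′ : ∀ {v} → (∃ λ i → vertex i ≡ v) → InComp G t v
    in-comp′ (i , refl) = in-comp i

  tops-of : ∀ v → sum (λ t → 𝟙 (top? t ×-dec inComp? t v)) ≡ 𝟙 (cyc? v)
  tops-of v with cyc? v
  ... | yes cv = let t , top-t , t~v = top-exists cv in
    sum-𝟙-unique-witness (λ t → top? t ×-dec inComp? t v) (top-t , t~v)
      (λ (top-t′ , t′~v) → top-unique (reach-trans t′~v (reach-sym t~v)) top-t′ top-t)
  ... | no  lv = sum-≗0 (λ t → 𝟙 (top? t ×-dec inComp? t v)) (λ t → 𝟙-no (top? t ×-dec inComp? t v) (lv ∘ inComp-cyc ∘ proj₂))

  sum-by-component : ∀ h → sum (λ v → 𝟙 (cyc? v) * h v) ≡ sum (λ t → 𝟙 (top? t) * ∑-comp t h)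
  sum-by-component h = sym (begin
    sum (λ t → 𝟙 (top? t) * ∑-comp t h)                               ≡⟨ sum-cong-≗ (λ t → *-distribˡ-sum (𝟙 (top? t)) (λ v → 𝟙 (inComp? t v) * h v)) ⟩
    sum (λ t → sum (λ v → 𝟙 (top? t) * (𝟙 (inComp? t v) * h v)))     ≡⟨ ∑-comm (λ t v → 𝟙 (top? t) * (𝟙 (inComp? t v) * h v)) ⟩
    sum (λ v → sum (λ t → 𝟙 (top? t) * (𝟙 (inComp? t v) * h v)))     ≡⟨ sum-cong-≗ (λ v → sum-cong-≗ (λ t → regroup t v)) ⟩
    sum (λ v → sum (λ t → 𝟙 (top? t ×-dec inComp? t v) * h v))       ≡⟨ sum-cong-≗ (λ v → sym (*-distribʳ-sum (h v) (λ t → 𝟙 (top? t ×-dec inComp? t v)))) ⟩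
    sum (λ v → sum (λ t → 𝟙 (top? t ×-dec inComp? t v)) * h v)       ≡⟨ sum-cong-≗ (λ v → cong (_* h v) (tops-of v)) ⟩
    sum (λ v → 𝟙 (cyc? v) * h v)                                      ∎)
    where
    open ≡-Reasoning
    regroup : ∀ t v → 𝟙 (top? t) * (𝟙 (inComp? t v) * h v) ≡ 𝟙 (top? t ×-dec inComp? t v) * h v
    regroup t v = trans (sym (ℕ.*-assoc (𝟙 (top? t)) _ (h v))) (cong (_* h v) (sym (𝟙-× (top? t) (inComp? t v))))

  cycDeg linkDeg : Fin n → ℕ
  cycDeg  v = sum (λ u → 𝟙 (Adj? v u ×-dec cyc? u))
  linkDeg v = sum (λ u → 𝟙 (Adj? v u ×-dec ¬? (cyc? u)))

  deg≡cycDeg+linkDeg : ∀ v → deg G v ≡ cycDeg v + linkDeg v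
  deg≡cycDeg+linkDeg v = trans (deg≡sum𝟙 v) (trans (sum-cong-≗ (λ u → 𝟙-split (Adj? v u) (cyc? u)))
                               (∑-distrib-+ (λ u → 𝟙 (Adj? v u ×-dec cyc? u)) (λ u → 𝟙 (Adj? v u ×-dec ¬? (cyc? u)))))

  cycDeg-enumeration : ∀ {t} (E : Enumeration t) i →
    cycDeg (Enumeration.vertex E i) ≡ sum (λ j → 𝟙 (Adj? (Enumeration.vertex E i) (Enumeration.vertex E j)))
  cycDeg-enumeration {t} E i = trans (sum-cong-≗ in-comp-nbr) (sum-image injective (λ u → 𝟙 (Adj? (vertex i) u)))
    where
    open Enumeration E
    in-comp-nbr : ∀ u → 𝟙 (Adj? (vertex i) u ×-dec cyc? u) ≡ 𝟙 (inImage? injective u) * 𝟙 (Adj? (vertex i) u)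
    in-comp-nbr u = trans (𝟙-cong (Adj? (vertex i) u ×-dec cyc? u) (inImage? injective u ×-dec Adj? (vertex i) u)
                             (mk⇔ (λ (a , cu) → complete (reach-trans (in-comp i) (inComp-edge (inComp-cyc (in-comp i)) cu a)) , a)
                                  (λ ((j , e) , a) → a , subst Cyc e (inComp-cyc (in-comp j)))))
                          (𝟙-× (inImage? injective u) (Adj? (vertex i) u))

  linkDeg-by-cycDeg : ∀ {t} (E : Enumeration t) i → linkDeg (Enumeration.vertex E i) ≡ Δ ∸ cycDeg (Enumeration.vertex E i)
  linkDeg-by-cycDeg E i = sym (begin
    Δ ∸ cycDeg v                  ≡⟨ cong (_∸ cycDeg v) (trans (sym (deg-cyc v (inComp-cyc (Enumeration.in-comp E i)))) (deg≡cycDeg+linkDeg v)) ⟩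
    cycDeg v + linkDeg v ∸ cycDeg v ≡⟨ ℕ.m+n∸m≡n (cycDeg v) (linkDeg v) ⟩
    linkDeg v                     ∎)
    where
    open ≡-Reasoning
    v = Enumeration.vertex E i

  D Q : ℕ
  D = Δ * Δ / 4 + Δ
  Q = D ∸ Δ

  Q≡Δ*Δ/4 : Q ≡ Δ * Δ / 4
  Q≡Δ*Δ/4 = ℕ.m+n∸n≡m (Δ * Δ / 4) Δ

  record Choice (t : Fin n) : Set₁ where
    field
      enum : Enumeration t
    open Enumeration enum public
    field
      Chosen             : Pred (Fin size) 0ℓ
      chosen?            : Decidable Chosen
      count ext          : ℕ
      top-index          : Fin size
      vertex-top         : vertex top-index ≡ t
      top-unchosen       : ¬ Chosen top-index
      chosen-independent : ∀ {i j} → Chosen i → Chosen j → ¬ Adj G (vertex i) (vertex j)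
      chosen-dominating  : ∀ i → ¬ Chosen i → ∃ λ j → Chosen j × Adj G (vertex i) (vertex j)
      ∑chosen            : sum (λ i → 𝟙 (chosen? i)) ≡ count
      independent-≤      : ∀ {S : Pred (Fin size) 0ℓ} (S? : Decidable S) →
                           (∀ {i j} → S i → S j → ¬ Adj G (vertex i) (vertex j)) → sum (λ i → 𝟙 (S? i)) ≤ count
      linkDeg-vertex     : ∀ i → linkDeg (vertex i) ≡ ext
      1≤ext              : 1 ≤ ext
      balanced           : Balanced D Q size count ext

  cliqueChoice : ∀ {t} → Cyc t → ∀ q → q ≡ ⌈ Δ /2⌉ ⊎ q ≡ ⌊ Δ /2⌋ → CompIsComplete G t (q + 1) → Choice t
  cliqueChoice {t} ct q q-half (f , f-inj , f-onto , f-adj) = record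
    { enum = E ; Chosen = _≡ j ; chosen? = Fin._≟ j ; count = 1 ; ext = Δ ∸ q
    ; top-index = i₀ ; vertex-top = fi₀≡t ; top-unchosen = j≢i₀ ∘ sym
    ; chosen-independent = λ { refl refl jj → adj⇒≢ jj refl }
    ; chosen-dominating = λ i i≢j → j , refl , f-adj i j i≢j
    ; ∑chosen = sum-𝟙-unique-witness (Fin._≟ j) refl (λ e → e)
    ; independent-≤ = λ S? independent → subst (_≤ 1) (sym (sum-𝟙-unique S? (at-most-one independent))) (𝟙≤1 (Fin.any? S?))
    ; linkDeg-vertex = linkDeg≡ ; 1≤ext = ℕ.m<n⇒0<n∸m (half<Δ q-half 4≤Δ)
    ; balanced = subst₂ (λ D Q → Balanced D Q (q + 1) 1 (Δ ∸ q)) (sym D≡) (sym (trans Q≡Δ*Δ/4 (sym q*e≡))) (clique-balanced q (Δ ∸ q))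
    }
    where
    E = enumeration f f-inj f-onto
    i₀ = proj₁ (Equivalence.to (f-onto t) (inComp-refl ct))
    fi₀≡t = proj₂ (Equivalence.to (f-onto t) (inComp-refl ct))
    j = proj₁ (another (ℕ.≤-trans (2≤half q-half 4≤Δ) (ℕ.m≤m+n q 1)) i₀)
    j≢i₀ = proj₂ (another (ℕ.≤-trans (2≤half q-half 4≤Δ) (ℕ.m≤m+n q 1)) i₀)
    at-most-one : ∀ {S : Pred (Fin (q + 1)) 0ℓ} → (∀ {i j} → S i → S j → ¬ Adj G (f i) (f j)) → ∀ {i j} → S i → S j → i ≡ j
    at-most-one independent {i} {j} si sj with i Fin.≟ j
    ... | yes i≡j = i≡j
    ... | no  i≢j = contradiction (f-adj i j i≢j) (independent si sj)
    cycDeg≡q : ∀ i → cycDeg (f i) ≡ q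
    cycDeg≡q i = trans (cycDeg-enumeration E i) (trans (sum-cong-≗ (λ k → 𝟙-cong (Adj? (f i) (f k)) (¬? (k Fin.≟ i))
                         (mk⇔ (λ a k≡i → adj⇒≢ a (cong f (sym k≡i))) (λ k≢i → f-adj i k (k≢i ∘ sym)))))
                       (ℕ.+-cancelˡ-≡ 1 _ q (trans (1+sum-𝟙-≢ i) (ℕ.+-comm q 1))))
    linkDeg≡ : ∀ i → linkDeg (f i) ≡ Δ ∸ q
    linkDeg≡ i = trans (linkDeg-by-cycDeg E i) (cong (Δ ∸_) (cycDeg≡q i))
    q*e≡ : q * (Δ ∸ q) ≡ Δ * Δ / 4
    q*e≡ = half*rest≡Δ*Δ/4 q-half
    D≡ : D ≡ q * (Δ ∸ q) + (q + (Δ ∸ q))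
    D≡ = cong₂ _+_ (sym q*e≡) (sym (ℕ.m+[n∸m]≡n (ℕ.<⇒≤ (half<Δ q-half 4≤Δ))))

  oddCycleChoice : ∀ {t} → Cyc t → Δ ≡ 4 → CompIsOddCycle G t → Choice t
  oddCycleChoice {t} ct Δ≡4 (k , f , f-inj , f-onto , f-adj) = record
    { enum = E ; Chosen = λ i → chosen c i ≡ true ; chosen? = λ i → chosen c i Bool.≟ true ; count = suc k ; ext = 2
    ; top-index = c ; vertex-top = fc≡t ; top-unchosen = λ cc → contradiction (trans (sym cc) (chosen-self c)) λ ()
    ; chosen-independent = λ {i} {j} ci cj a → [ chosen-independent c {i} {j} ci cj , chosen-independent c {j} {i} cj ci ]′ (Equivalence.to (f-adj i j) a)
    ; chosen-dominating = λ i ¬ci → let j , cj , nbr = chosen-dominating c i (Bool.¬-not ¬ci) in j , cj , Equivalence.from (f-adj i j) nbr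
    ; ∑chosen = ∑chosen c
    ; independent-≤ = λ S? independent → independent-≤ S? (λ si sj next → independent si sj (Equivalence.from (f-adj _ _) (inj₁ next)))
    ; linkDeg-vertex = linkDeg≡2 ; 1≤ext = s≤s z≤n
    ; balanced = subst₂ (λ D Q → Balanced D Q (3 + 2 * k) (suc k) 2) (sym (cong (λ x → x * x / 4 + x) Δ≡4))
                        (sym (trans Q≡Δ*Δ/4 (cong (λ x → x * x / 4) Δ≡4))) (oddCycle-balanced k)
    }
    where
    open OddCycleChoice k
    E = enumeration f f-inj f-onto
    c = proj₁ (Equivalence.to (f-onto t) (inComp-refl ct))
    fc≡t = proj₂ (Equivalence.to (f-onto t) (inComp-refl ct))
    cycDeg≡2 : ∀ i → cycDeg (f i) ≡ 2
    cycDeg≡2 i = trans (cycDeg-enumeration E i) (trans (sum-cong-≗ (λ j → 𝟙-cong (Adj? (f i) (f j)) (next? i j ⊎-dec next? j i) (f-adj i j)))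
                       (sum-𝟙-next-or-prev (s≤s (s≤s z≤n)) i))
    linkDeg≡2 : ∀ i → linkDeg (f i) ≡ 2
    linkDeg≡2 i = trans (linkDeg-by-cycDeg E i) (cong₂ _∸_ Δ≡4 (cycDeg≡2 i))

  shapeChoice : ∀ {t} → Cyc t → Shape t → Choice t
  shapeChoice ct (clique q q-half K) = cliqueChoice ct q q-half K
  shapeChoice ct (oddCycle Δ≡4 C)    = oddCycleChoice ct Δ≡4 C

  -- The proof of Cyc t is irrelevant, so the choice made at a top cannot depend on how we know it is a top.
  choice : ∀ t → .(Cyc t) → Choice t
  choice t ct with cyc? t
  ... | yes ct′ = shapeChoice ct′ (shape t ct′)
  ... | no  lt  = ⊥-elim-irr (lt ct)

  choiceAt : ∀ {t} → Top t → Choice t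
  choiceAt {t} top-t = choice t (proj₁ top-t)

  PickedAt : Fin n → Fin n → Set
  PickedAt t u = Σ (Top t) λ top-t → let open Choice (choiceAt top-t) in ∃ λ i → vertex i ≡ u × Chosen i

  Picked : Pred (Fin n) 0ℓ
  Picked u = ∃ λ t → PickedAt t u

  pickedAt? : ∀ t u → Dec (PickedAt t u)
  pickedAt? t u with top? t
  ... | no  ¬top = no (¬top ∘ proj₁)
  ... | yes top-t with Fin.any? (λ i → (vertex i Fin.≟ u) ×-dec chosen? i)
    where open Choice (choiceAt top-t)
  ...   | yes (i , fi≡u , ci) = yes (top-t , i , fi≡u , ci)
  ...   | no  none            = no (λ (_ , i , fi≡u , ci) → none (i , fi≡u , ci))

  picked? : Decidable Picked
  picked? u = Fin.any? (λ t → pickedAt? t u)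

  pickedAt-inComp : ∀ {t u} → PickedAt t u → InComp G t u
  pickedAt-inComp (top-t , i , refl , _) = Choice.in-comp (choiceAt top-t) i

  picked-cyc : ∀ {u} → Picked u → Cyc u
  picked-cyc (_ , p) = inComp-cyc (pickedAt-inComp p)

  chosen⇒picked : ∀ {t} (top-t : Top t) {i} → Choice.Chosen (choiceAt top-t) i → Picked (Choice.vertex (choiceAt top-t) i)
  chosen⇒picked top-t {i} ci = _ , top-t , i , refl , ci

  picked⇒chosen : ∀ {t} (top-t : Top t) i → Picked (Choice.vertex (choiceAt top-t) i) → Choice.Chosen (choiceAt top-t) i
  picked⇒chosen top-t i (t′ , p@(top-t′ , j , fj≡fi , cj))
    with top-unique (reach-trans (Choice.in-comp (choiceAt top-t) i) (reach-sym (pickedAt-inComp p))) top-t top-t′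
  ... | refl = subst (Choice.Chosen (choiceAt top-t)) (Choice.injective (choiceAt top-t) fj≡fi) cj

  picked-not-top : ∀ {u} → Picked u → ¬ Top u
  picked-not-top (t , p@(top-t , i , refl , ci)) top-u =
    Choice.top-unchosen C (subst (Choice.Chosen C) (Choice.injective C (sym (trans (Choice.vertex-top C) t≡u))) ci)
    where
    C = choiceAt top-t
    t≡u = top-unique (pickedAt-inComp p) top-t top-u

  picked-independent : ∀ {u v} → Picked u → Picked v → ¬ Adj G u v
  picked-independent (t , p@(top-t , i , refl , ci)) (t′ , p′@(top-t′ , j , refl , cj)) uv
    with top-unique (reach-trans (pickedAt-inComp p) (reach-trans (inComp-edge (picked-cyc (t , p)) (picked-cyc (t′ , p′)) uv)
                                                                  (reach-sym (pickedAt-inComp p′)))) top-t top-t′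
  ... | refl = Choice.chosen-independent (choiceAt top-t) ci cj uv

  picked-dominating : ∀ {v} → Cyc v → ¬ Picked v → ∃ λ u → Picked u × Adj G v u
  picked-dominating cv ¬picked-v with top-exists cv
  ... | t , top-t , t~v with Choice.complete (choiceAt top-t) t~v
  ...   | j , refl with Choice.chosen? (choiceAt top-t) j
  ...     | yes cj = contradiction (chosen⇒picked top-t cj) ¬picked-v
  ...     | no ¬cj = let j′ , cj′ , a = Choice.chosen-dominating (choiceAt top-t) j ¬cj in _ , chosen⇒picked top-t cj′ , a

  picked-below-link : ∀ {w u} → Link w → Picked u → Adj G w u → dist u < dist w
  picked-below-link {w} {u} lw picked-u wu with ℕ.<-cmp (dist u) (dist w)
  ... | tri< du<dw _ _ = du<dw
  ... | tri≈ _ du≡dw _ = contradiction du≡dw (link-nbr-dist≢ lw wu)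
  ... | tri> _ _ dw<du = contradiction (picked-cyc picked-u , inj₂ (w , lw , adj-sym wu , dw<du)) (picked-not-top picked-u)

  link-picked-nbr-unique : ∀ {w u₁ u₂} → Link w → Picked u₁ → Picked u₂ → Adj G w u₁ → Adj G w u₂ → u₁ ≡ u₂
  link-picked-nbr-unique lw p₁ p₂ wu₁ wu₂ = link-lower-nbr-unique lw wu₁ wu₂ (picked-below-link lw p₁ wu₁) (picked-below-link lw p₂ wu₂)

  PickedNbr : Pred (Fin n) 0ℓ
  PickedNbr u = ∃ λ x → Picked x × Adj G x u

  pickedNbr? : Decidable PickedNbr
  pickedNbr? u = Fin.any? (λ x → picked? x ×-dec Adj? x u)

  InS₀ : Pred (Fin n) 0ℓ
  InS₀ u = Picked u ⊎ (Link u × ¬ PickedNbr u)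

  inS₀? : Decidable InS₀
  inS₀? u = picked? u ⊎-dec (¬? (cyc? u) ×-dec ¬? (pickedNbr? u))

  S₀ : Subset n
  S₀ = fromDec inS₀?

  ∈S₀⇔ : ∀ {u} → u ∈ S₀ ⇔ InS₀ u
  ∈S₀⇔ = ∈-fromDec inS₀?

  S₀-independent : Independent G S₀
  S₀-independent u v u∈ v∈ = independent (Equivalence.to ∈S₀⇔ u∈) (Equivalence.to ∈S₀⇔ v∈)
    where
    independent : InS₀ u → InS₀ v → ¬ Adj G u v
    independent (inj₁ pu)            (inj₁ pv)            uv = picked-independent pu pv uv
    independent (inj₁ pu)            (inj₂ (_ , ¬nbr-v))  uv = ¬nbr-v (u , pu , uv)
    independent (inj₂ (_ , ¬nbr-u))  (inj₁ pv)            uv = ¬nbr-u (v , pv , adj-sym uv)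
    independent (inj₂ (lu , _))      (inj₂ (lv , _))      uv = links-independent lu lv uv

  S₀-dominating : Dominating G S₀
  S₀-dominating v v∉ with cyc? v
  ... | yes cv with picked-dominating cv (v∉ ∘ Equivalence.from ∈S₀⇔ ∘ inj₁)
  ...   | u , pu , vu = u , Equivalence.from ∈S₀⇔ (inj₁ pu) , adj-sym vu
  S₀-dominating v v∉ | no lv with pickedNbr? v
  ...   | yes (x , px , xv) = x , Equivalence.from ∈S₀⇔ (inj₁ px) , xv
  ...   | no  ¬nbr          = contradiction (Equivalence.from ∈S₀⇔ (inj₂ (lv , ¬nbr))) v∉

  VanishesOnLinks : (Fin n → ℕ) → Set
  VanishesOnLinks h = ∀ v → Link v → h v ≡ 0

  sum-by-top : ∀ h → VanishesOnLinks h → sum h ≡ sum (λ t → 𝟙 (top? t) * ∑-comp t h)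
  sum-by-top h vanishes = trans (sum-cong-≗ restrict) (sum-by-component h)
    where
    restrict : ∀ v → h v ≡ 𝟙 (cyc? v) * h v
    restrict v with cyc? v
    ... | yes _  = sym (ℕ.*-identityˡ (h v))
    ... | no  lv = vanishes v lv

  sum-by-top-≡ : ∀ {f g} → VanishesOnLinks f → VanishesOnLinks g →
                 (∀ {t} → Top t → ∑-comp t f ≡ ∑-comp t g) → sum f ≡ sum g
  sum-by-top-≡ {f} {g} f-vanishes g-vanishes per-top = trans (sum-by-top f f-vanishes) (trans (sum-cong-≗ at) (sym (sum-by-top g g-vanishes)))
    where
    at : ∀ t → 𝟙 (top? t) * ∑-comp t f ≡ 𝟙 (top? t) * ∑-comp t g
    at t with top? t
    ... | yes top-t = cong (1 *_) (per-top top-t)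
    ... | no  _     = refl

  sum-by-top-≤ : ∀ {f g} → VanishesOnLinks f → VanishesOnLinks g →
                 (∀ {t} → Top t → ∑-comp t f ≤ ∑-comp t g) → sum f ≤ sum g
  sum-by-top-≤ {f} {g} f-vanishes g-vanishes per-top =
    subst₂ _≤_ (sym (sum-by-top f f-vanishes)) (sym (sum-by-top g g-vanishes)) (sum-mono-≤ at)
    where
    at : ∀ t → 𝟙 (top? t) * ∑-comp t f ≤ 𝟙 (top? t) * ∑-comp t g
    at t with top? t
    ... | yes top-t = ℕ.*-monoʳ-≤ 1 (per-top top-t)
    ... | no  _     = z≤n

  module AtTop {t} (top-t : Top t) where
    open Choice (choiceAt top-t) public

    ∑-comp-vertex : ∀ h → ∑-comp t h ≡ sum (h ∘ vertex)
    ∑-comp-vertex = ∑-comp-enumeration enum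

    𝟙-picked-vertex : ∀ i → 𝟙 (picked? (vertex i)) ≡ 𝟙 (chosen? i)
    𝟙-picked-vertex i = 𝟙-cong (picked? (vertex i)) (chosen? i) (mk⇔ (picked⇒chosen top-t i) (chosen⇒picked top-t))

    ∑picked : sum (λ i → 𝟙 (picked? (vertex i))) ≡ count
    ∑picked = trans (sum-cong-≗ 𝟙-picked-vertex) ∑chosen

    ∑picked*linkDeg : sum (λ i → 𝟙 (picked? (vertex i)) * linkDeg (vertex i)) ≡ count * ext
    ∑picked*linkDeg = begin
      sum (λ i → 𝟙 (picked? (vertex i)) * linkDeg (vertex i)) ≡⟨ sum-cong-≗ (λ i → cong₂ _*_ (𝟙-picked-vertex i) (linkDeg-vertex i)) ⟩
      sum (λ i → 𝟙 (chosen? i) * ext)                         ≡⟨ sym (*-distribʳ-sum ext (λ i → 𝟙 (chosen? i))) ⟩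
      sum (λ i → 𝟙 (chosen? i)) * ext                         ≡⟨ cong (_* ext) ∑chosen ⟩
      count * ext                                             ∎
      where open ≡-Reasoning

    ∑linkDeg : sum (λ i → linkDeg (vertex i)) ≡ size * ext
    ∑linkDeg = trans (sum-cong-≗ linkDeg-vertex) (sum-const size ext)

    ∑cyc : sum (λ i → 𝟙 (cyc? (vertex i))) ≡ size
    ∑cyc = trans (sum-cong-≗ (λ i → 𝟙-yes (cyc? (vertex i)) (inComp-cyc (in-comp i)))) (trans (sum-const size 1) (ℕ.*-identityʳ size))

    ∑top : sum (λ i → 𝟙 (top? (vertex i))) ≡ 1
    ∑top = sum-𝟙-unique-witness (λ i → top? (vertex i)) (subst Top (sym vertex-top) top-t)
             (λ {i} top-i → injective (trans (top-unique (reach-sym (in-comp i)) top-i top-t) (sym vertex-top)))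

  #links #picked #lowered : ℕ
  #links   = sum (λ v → 𝟙 (¬? (cyc? v)))
  #picked  = sum (λ v → 𝟙 (picked? v))
  #lowered = sum (λ v → 𝟙 (hasLowerLink? v))

  LinkEdge? : ∀ v u → Dec (Adj G v u × Link u)
  LinkEdge? v u = Adj? v u ×-dec ¬? (cyc? u)

  linkDeg-link : ∀ {v} → Link v → linkDeg v ≡ 0
  linkDeg-link {v} lv = sum-≗0 (λ u → 𝟙 (LinkEdge? v u)) (λ u → 𝟙-no (LinkEdge? v u) (λ (vu , lu) → links-independent lv lu vu))

  ∑𝟙*linkDeg : ∀ {A : Pred (Fin n) 0ℓ} (A? : Decidable A) →
                sum (λ v → 𝟙 (A? v) * linkDeg v) ≡ sum (λ u → sum (λ v → 𝟙 (A? v ×-dec LinkEdge? v u)))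
  ∑𝟙*linkDeg A? = begin
    sum (λ v → 𝟙 (A? v) * linkDeg v)                          ≡⟨ sum-cong-≗ (λ v → *-distribˡ-sum (𝟙 (A? v)) (λ u → 𝟙 (LinkEdge? v u))) ⟩
    sum (λ v → sum (λ u → 𝟙 (A? v) * 𝟙 (LinkEdge? v u)))     ≡⟨ sum-cong-≗ (λ v → sum-cong-≗ (λ u → sym (𝟙-× (A? v) (LinkEdge? v u)))) ⟩
    sum (λ v → sum (λ u → 𝟙 (A? v ×-dec LinkEdge? v u)))     ≡⟨ ∑-comm (λ v u → 𝟙 (A? v ×-dec LinkEdge? v u)) ⟩
    sum (λ u → sum (λ v → 𝟙 (A? v ×-dec LinkEdge? v u)))     ∎
    where open ≡-Reasoning

  ∑upward : ∀ v → sum (λ u → 𝟙 (LinkEdge? v u ×-dec (dist u ℕ.<? dist v))) ≡ 𝟙 (hasLowerLink? v)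
  ∑upward v = trans (sum-𝟙-unique (λ u → LinkEdge? v u ×-dec (dist u ℕ.<? dist v))
                      (λ ((vu₁ , lu₁) , d₁) ((vu₂ , lu₂) , d₂) → lower-link-unique vu₁ vu₂ lu₁ lu₂ d₁ d₂))
                    (𝟙-cong (Fin.any? _) (hasLowerLink? v) (mk⇔ (λ (w , (vw , lw) , d) → w , lw , vw , d) (λ (w , lw , vw , d) → w , (vw , lw) , d)))

  ∑downward : ∀ u → sum (λ v → 𝟙 (LinkEdge? v u ×-dec ¬? (dist u ℕ.<? dist v))) ≡ 𝟙 (¬? (cyc? u))
  ∑downward u = 𝟙¬-cases (cyc? u) (λ cu → sum-≗0 down (λ v → 𝟙-no (LinkEdge? v u ×-dec _) (λ ((_ , lu) , _) → lu cu))) at-parent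
    where
    down : Fin n → ℕ
    down v = 𝟙 (LinkEdge? v u ×-dec ¬? (dist u ℕ.<? dist v))
    at-parent : Link u → sum down ≡ 1
    at-parent lu with parent (link≢root lu)
    ... | p , up , dp<du = sum-𝟙-unique-witness (λ v → LinkEdge? v u ×-dec ¬? (dist u ℕ.<? dist v))
                             ((adj-sym up , lu) , ℕ.<⇒≯ (ℕ.≤-reflexive dp<du))
                             (λ ((vu , _) , du≮dv) → link-lower-nbr-unique lu (adj-sym vu) up (below vu du≮dv) (ℕ.≤-reflexive dp<du))
      where
      below : ∀ {v} → Adj G v u → ¬ dist u < dist v → dist v < dist u
      below vu du≮dv = ℕ.≤∧≢⇒< (ℕ.≮⇒≥ du≮dv) (link-nbr-dist≢ lu (adj-sym vu))

  ∑linkDeg≡#lowered+#links : sum linkDeg ≡ #lowered + #links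
  ∑linkDeg≡#lowered+#links = begin
    sum linkDeg                                                            ≡⟨ sum-cong-≗ (λ v → sum-cong-≗ (λ u → 𝟙-split (LinkEdge? v u) (dist u ℕ.<? dist v))) ⟩
    sum (λ v → sum (λ u → up v u + down v u))                              ≡⟨ sum-cong-≗ (λ v → ∑-distrib-+ (up v) (down v)) ⟩
    sum (λ v → sum (up v) + sum (down v))                                  ≡⟨ ∑-distrib-+ (λ v → sum (up v)) (λ v → sum (down v)) ⟩
    sum (λ v → sum (up v)) + sum (λ v → sum (down v))                      ≡⟨ cong₂ _+_ (sum-cong-≗ ∑upward) (∑-comm down) ⟩
    #lowered + sum (λ u → sum (λ v → down v u))                            ≡⟨ cong (#lowered +_) (sum-cong-≗ ∑downward) ⟩
    #lowered + #links                                                      ∎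
    where
    open ≡-Reasoning
    up down : Fin n → Fin n → ℕ
    up   v u = 𝟙 (LinkEdge? v u ×-dec (dist u ℕ.<? dist v))
    down v u = 𝟙 (LinkEdge? v u ×-dec ¬? (dist u ℕ.<? dist v))

  lowerLink⇒cyc : ∀ {v} → HasLowerLink v → Cyc v
  lowerLink⇒cyc (_ , lw , vw , _) = link-nbr-cyc lw (adj-sym vw)

  #tops≡1+#lowered : sum (λ v → 𝟙 (top? v)) ≡ 1 + #lowered
  #tops≡1+#lowered = begin
    sum (λ v → 𝟙 (top? v))                                             ≡⟨ sum-cong-≗ split ⟩
    sum (λ v → 𝟙 (cyc? v ×-dec v Fin.≟ r) + 𝟙 (hasLowerLink? v))       ≡⟨ ∑-distrib-+ (λ v → 𝟙 (cyc? v ×-dec v Fin.≟ r)) (λ v → 𝟙 (hasLowerLink? v)) ⟩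
    sum (λ v → 𝟙 (cyc? v ×-dec v Fin.≟ r)) + #lowered                 ≡⟨ cong (_+ #lowered) (sum-𝟙-unique-witness (λ v → cyc? v ×-dec v Fin.≟ r) (r-cyc , refl) proj₂) ⟩
    1 + #lowered                                                        ∎
    where
    open ≡-Reasoning
    root-not-lowered : ∀ {v} → v ≡ r → ¬ HasLowerLink v
    root-not-lowered refl (w , _ , _ , dw<dr) = ℕ.n≮0 (subst (dist w <_) dist-root dw<dr)
    split : ∀ v → 𝟙 (top? v) ≡ 𝟙 (cyc? v ×-dec v Fin.≟ r) + 𝟙 (hasLowerLink? v)
    split v = begin
      𝟙 (top? v)                                                 ≡⟨ 𝟙-× (cyc? v) ((v Fin.≟ r) ⊎-dec hasLowerLink? v) ⟩
      𝟙 (cyc? v) * 𝟙 ((v Fin.≟ r) ⊎-dec hasLowerLink? v)         ≡⟨ cong (𝟙 (cyc? v) *_) (𝟙-⊎ (v Fin.≟ r) (hasLowerLink? v) root-not-lowered) ⟩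
      𝟙 (cyc? v) * (𝟙 (v Fin.≟ r) + 𝟙 (hasLowerLink? v))         ≡⟨ ℕ.*-distribˡ-+ (𝟙 (cyc? v)) _ _ ⟩
      𝟙 (cyc? v) * 𝟙 (v Fin.≟ r) + 𝟙 (cyc? v) * 𝟙 (hasLowerLink? v) ≡⟨ cong₂ _+_ (sym (𝟙-× (cyc? v) (v Fin.≟ r))) (𝟙*-absorb (cyc? v) (hasLowerLink? v) lowerLink⇒cyc) ⟩
      𝟙 (cyc? v ×-dec v Fin.≟ r) + 𝟙 (hasLowerLink? v)            ∎

  ∣S₀∣+∑picked*linkDeg : ∣ S₀ ∣ + sum (λ v → 𝟙 (picked? v) * linkDeg v) ≡ #picked + #links
  ∣S₀∣+∑picked*linkDeg = begin
    ∣ S₀ ∣ + sum (λ v → 𝟙 (picked? v) * linkDeg v)     ≡⟨ cong₂ _+_ ∣S₀∣≡ (trans (∑𝟙*linkDeg picked?) (sum-cong-≗ covered)) ⟩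
    (#picked + sum lonely) + sum served                ≡⟨ ℕ.+-assoc #picked (sum lonely) (sum served) ⟩
    #picked + (sum lonely + sum served)                ≡⟨ cong (#picked +_) (trans (ℕ.+-comm (sum lonely) (sum served)) (sym #links≡)) ⟩
    #picked + #links                                   ∎
    where
    open ≡-Reasoning
    lonely served : Fin n → ℕ
    lonely u = 𝟙 (¬? (cyc? u) ×-dec ¬? (pickedNbr? u))
    served u = 𝟙 (¬? (cyc? u) ×-dec pickedNbr? u)
    ∣S₀∣≡ : ∣ S₀ ∣ ≡ #picked + sum lonely
    ∣S₀∣≡ = trans (∣fromDec∣ inS₀?) (trans (sum-cong-≗ (λ u → 𝟙-⊎ (picked? u) (¬? (cyc? u) ×-dec ¬? (pickedNbr? u)) (λ pu (lu , _) → lu (picked-cyc pu))))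
                                            (∑-distrib-+ (λ u → 𝟙 (picked? u)) lonely))
    covered : ∀ u → sum (λ v → 𝟙 (picked? v ×-dec LinkEdge? v u)) ≡ served u
    covered u = trans (sum-𝟙-unique (λ v → picked? v ×-dec LinkEdge? v u)
                        (λ (p₁ , v₁u , lu) (p₂ , v₂u , _) → link-picked-nbr-unique lu p₁ p₂ (adj-sym v₁u) (adj-sym v₂u)))
                      (𝟙-cong (Fin.any? _) (¬? (cyc? u) ×-dec pickedNbr? u)
                        (mk⇔ (λ (v , pv , vu , lu) → lu , v , pv , vu) (λ (lu , v , pv , vu) → v , pv , vu , lu)))
    #links≡ : #links ≡ sum served + sum lonely
    #links≡ = trans (sum-cong-≗ (λ u → 𝟙-split (¬? (cyc? u)) (pickedNbr? u))) (∑-distrib-+ served lonely)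

  #cyc+#links≡n : sum (λ v → 𝟙 (cyc? v)) + #links ≡ n
  #cyc+#links≡n = trans (sym (∑-distrib-+ (λ v → 𝟙 (cyc? v)) (λ v → 𝟙 (¬? (cyc? v)))))
                        (trans (sum-cong-≗ (λ v → 𝟙+𝟙¬≡1 (cyc? v))) (trans (sum-const n 1) (ℕ.*-identityʳ n)))

  𝟙-link : ∀ {p} {P : Pred (Fin n) p} (P? : Decidable P) → (∀ {v} → P v → Cyc v) → ∀ {v} → Link v → 𝟙 (P? v) ≡ 0
  𝟙-link P? P⇒cyc lv = 𝟙-no (P? _) (lv ∘ P⇒cyc)

  weightL weightR : Fin n → ℕ
  weightL v = D * (𝟙 (picked? v) + linkDeg v) + Q * 𝟙 (top? v)
  weightR v = D * (𝟙 (top? v) + 𝟙 (picked? v) * linkDeg v) + Q * (𝟙 (cyc? v) + linkDeg v)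

  weightL-vanishes : VanishesOnLinks weightL
  weightL-vanishes v lv = trans (cong₂ (λ x y → D * x + Q * y) (cong₂ _+_ (𝟙-link picked? picked-cyc lv) (linkDeg-link lv)) (𝟙-link top? proj₁ lv))
                           (cong₂ _+_ (ℕ.*-zeroʳ D) (ℕ.*-zeroʳ Q))

  weightR-vanishes : VanishesOnLinks weightR
  weightR-vanishes v lv = trans (cong₂ (λ x y → D * x + Q * y) (cong₂ _+_ (𝟙-link top? proj₁ lv) (cong (_* linkDeg v) (𝟙-link picked? picked-cyc lv)))
                                                        (cong₂ _+_ (𝟙-link cyc? (λ cv → cv) lv) (linkDeg-link lv)))
                           (cong₂ _+_ (ℕ.*-zeroʳ D) (ℕ.*-zeroʳ Q))

  component-balanced : ∀ {t} → Top t → ∑-comp t weightL ≡ ∑-comp t weightR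
  component-balanced top-t = begin
    ∑-comp _ weightL                                        ≡⟨ ∑-comp-vertex weightL ⟩
    sum (λ i → D * (p i + l i) + Q * τ i)              ≡⟨ sum-linear D Q (λ i → p i + l i) τ ⟩
    D * sum (λ i → p i + l i) + Q * sum τ              ≡⟨ cong₂ (λ x y → D * x + Q * y) (trans (∑-distrib-+ p l) (cong₂ _+_ ∑picked ∑linkDeg)) ∑top ⟩
    D * (count + size * ext) + Q * 1                   ≡⟨ cong (D * (count + size * ext) +_) (ℕ.*-identityʳ Q) ⟩
    D * (count + size * ext) + Q                       ≡⟨ balanced ⟩
    D * (1 + count * ext) + Q * (size + size * ext)    ≡⟨ sym (cong₂ (λ x y → D * x + Q * y) (trans (∑-distrib-+ τ pl) (cong₂ _+_ ∑top ∑picked*linkDeg))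
                                                                                             (trans (∑-distrib-+ c l) (cong₂ _+_ ∑cyc ∑linkDeg))) ⟩
    D * sum (λ i → τ i + pl i) + Q * sum (λ i → c i + l i) ≡⟨ sym (sum-linear D Q (λ i → τ i + pl i) (λ i → c i + l i)) ⟩
    sum (λ i → D * (τ i + pl i) + Q * (c i + l i))     ≡⟨ sym (∑-comp-vertex weightR) ⟩
    ∑-comp _ weightR                                        ∎
    where
    open ≡-Reasoning
    open AtTop top-t
    p l τ c pl : Fin size → ℕ
    p  i = 𝟙 (picked? (vertex i))
    l  i = linkDeg (vertex i)
    τ  i = 𝟙 (top? (vertex i))
    c  i = 𝟙 (cyc? (vertex i))
    pl i = p i * l i

  S₀-size : D * ∣ S₀ ∣ ≡ Q * (n ∸ 1) + D
  S₀-size = balance-sum D Q sums ∑linkDeg≡#lowered+#links #tops≡1+#lowered ∣S₀∣+∑picked*linkDeg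
                        (trans #cyc+#links≡n (1+pred r))
    where
    1+pred : ∀ {m} → Fin m → m ≡ suc (m ∸ 1)
    1+pred {suc _} _ = refl
    p l τ c : Fin n → ℕ
    p v = 𝟙 (picked? v)
    l   = linkDeg
    τ v = 𝟙 (top? v)
    c v = 𝟙 (cyc? v)
    sums : D * (sum p + sum l) + Q * sum τ ≡ D * (sum τ + sum (λ v → p v * l v)) + Q * (sum c + sum l)
    sums = begin
      D * (sum p + sum l) + Q * sum τ                                  ≡⟨ cong (λ x → D * x + Q * sum τ) (sym (∑-distrib-+ p l)) ⟩
      D * sum (λ v → p v + l v) + Q * sum τ                            ≡⟨ sym (sum-linear D Q (λ v → p v + l v) τ) ⟩
      sum weightL                                                           ≡⟨ sum-by-top-≡ weightL-vanishes weightR-vanishes component-balanced ⟩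
      sum weightR                                                           ≡⟨ sum-linear D Q (λ v → τ v + p v * l v) (λ v → c v + l v) ⟩
      D * sum (λ v → τ v + p v * l v) + Q * sum (λ v → c v + l v)      ≡⟨ cong₂ (λ x y → D * x + Q * y) (∑-distrib-+ τ (λ v → p v * l v)) (∑-distrib-+ c l) ⟩
      D * (sum τ + sum (λ v → p v * l v)) + Q * (sum c + sum l)        ∎
      where open ≡-Reasoning

  module Against (S : Subset n) (S-independent : Independent G S) (S-dominating : Dominating G S) where

    in? : Decidable (_∈ S)
    in? v = v Subset.∈? S

    X Y in-cyc : ℕ
    X      = sum (λ v → 𝟙 (picked? v) * linkDeg v)
    Y      = sum (λ v → 𝟙 (in? v) * linkDeg v)
    in-cyc = sum (λ v → 𝟙 (in? v ×-dec cyc? v))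

    #links+in-cyc≤∣S∣+Y : #links + in-cyc ≤ ∣ S ∣ + Y
    #links+in-cyc≤∣S∣+Y = begin
      #links + in-cyc                       ≡⟨ cong (_+ in-cyc) #links≡ ⟩
      (in-link + sum outside-link) + in-cyc ≤⟨ ℕ.+-monoˡ-≤ in-cyc (ℕ.+-monoʳ-≤ in-link outside≤) ⟩
      (in-link + Y) + in-cyc                ≡⟨ rearrange in-link Y in-cyc ⟩
      (in-cyc + in-link) + Y                ≡⟨ cong (_+ Y) (sym ∣S∣≡) ⟩
      ∣ S ∣ + Y                             ∎
      where
      open ℕ.≤-Reasoning
      in-link : ℕ
      in-link = sum (λ v → 𝟙 (in? v ×-dec ¬? (cyc? v)))
      outside-link : Fin n → ℕ
      outside-link v = 𝟙 (¬? (cyc? v) ×-dec ¬? (in? v))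
      ∣S∣≡ : ∣ S ∣ ≡ in-cyc + in-link
      ∣S∣≡ = trans (∣∣≡sum𝟙∈ S) (trans (sum-cong-≗ (λ v → 𝟙-split (in? v) (cyc? v)))
                                       (∑-distrib-+ (λ v → 𝟙 (in? v ×-dec cyc? v)) (λ v → 𝟙 (in? v ×-dec ¬? (cyc? v)))))
      #links≡ : #links ≡ in-link + sum outside-link
      #links≡ = trans (sum-cong-≗ (λ v → trans (𝟙-split (¬? (cyc? v)) (in? v)) (cong (_+ outside-link v) (𝟙-swap (¬? (cyc? v)) (in? v)))))
                      (∑-distrib-+ (λ v → 𝟙 (in? v ×-dec ¬? (cyc? v))) outside-link)
      dominated : ∀ u → outside-link u ≤ sum (λ v → 𝟙 (in? v ×-dec LinkEdge? v u))
      dominated u with ¬? (cyc? u) ×-dec ¬? (in? u)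
      ... | no  _          = z≤n
      ... | yes (lu , u∉S) = let x , x∈S , xu = S-dominating u u∉S in
        ℕ.≤-trans (ℕ.≤-reflexive (sym (𝟙-yes (in? x ×-dec LinkEdge? x u) (x∈S , xu , lu))))
                  (term≤sum (λ v → 𝟙 (in? v ×-dec LinkEdge? v u)) x)
      outside≤ : sum outside-link ≤ Y
      outside≤ = ℕ.≤-trans (sum-mono-≤ dominated) (ℕ.≤-reflexive (sym (∑𝟙*linkDeg in?)))
      rearrange : ∀ a b c → (a + b) + c ≡ (c + a) + b
      rearrange = solve-∀

    boundL boundR : Fin n → ℕ
    boundL v = 𝟙 (picked? v) + 𝟙 (in? v) * linkDeg v
    boundR v = 𝟙 (picked? v) * linkDeg v + 𝟙 (in? v ×-dec cyc? v)

    boundL-vanishes : VanishesOnLinks boundL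
    boundL-vanishes v lv = cong₂ _+_ (𝟙-link picked? picked-cyc lv) (trans (cong (𝟙 (in? v) *_) (linkDeg-link lv)) (ℕ.*-zeroʳ (𝟙 (in? v))))

    boundR-vanishes : VanishesOnLinks boundR
    boundR-vanishes v lv = cong₂ _+_ (cong (_* linkDeg v) (𝟙-link picked? picked-cyc lv)) (𝟙-link (λ v → in? v ×-dec cyc? v) proj₂ lv)

    component-bounded : ∀ {t} → Top t → ∑-comp t boundL ≤ ∑-comp t boundR
    component-bounded top-t = begin
      ∑-comp _ boundL                          ≡⟨ ∑-comp-vertex boundL ⟩
      sum (λ i → p i + s i * l i)              ≡⟨ ∑-distrib-+ p (λ i → s i * l i) ⟩
      sum p + sum (λ i → s i * l i)            ≡⟨ cong₂ _+_ ∑picked (trans (sum-cong-≗ (λ i → cong (s i *_) (linkDeg-vertex i))) (sym (*-distribʳ-sum ext s))) ⟩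
      count + sum s * ext                      ≤⟨ component-≤ (independent-≤ (λ i → in? (vertex i)) (S-independent _ _)) 1≤ext ⟩
      count * ext + sum s                      ≡⟨ sym (cong₂ _+_ ∑picked*linkDeg (sum-cong-≗ in-cyc-vertex)) ⟩
      sum (λ i → p i * l i) + sum (λ i → 𝟙 (in? (vertex i) ×-dec cyc? (vertex i))) ≡⟨ sym (∑-distrib-+ (λ i → p i * l i) _) ⟩
      sum (boundR ∘ vertex)                    ≡⟨ sym (∑-comp-vertex boundR) ⟩
      ∑-comp _ boundR                          ∎
      where
      open ℕ.≤-Reasoning
      open AtTop top-t
      p s l : Fin size → ℕ
      p i = 𝟙 (picked? (vertex i))
      s i = 𝟙 (in? (vertex i))
      l i = linkDeg (vertex i)
      in-cyc-vertex : ∀ i → 𝟙 (in? (vertex i) ×-dec cyc? (vertex i)) ≡ s i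
      in-cyc-vertex i = 𝟙-cong (in? (vertex i) ×-dec cyc? (vertex i)) (in? (vertex i)) (mk⇔ proj₁ (λ x → x , inComp-cyc (in-comp i)))

    #picked+Y≤X+in-cyc : #picked + Y ≤ X + in-cyc
    #picked+Y≤X+in-cyc = begin
      #picked + Y   ≡⟨ sym (∑-distrib-+ (λ v → 𝟙 (picked? v)) (λ v → 𝟙 (in? v) * linkDeg v)) ⟩
      sum boundL    ≤⟨ sum-by-top-≤ boundL-vanishes boundR-vanishes component-bounded ⟩
      sum boundR    ≡⟨ ∑-distrib-+ (λ v → 𝟙 (picked? v) * linkDeg v) (λ v → 𝟙 (in? v ×-dec cyc? v)) ⟩
      X + in-cyc    ∎
      where open ℕ.≤-Reasoning

  S₀-minimum : ∀ S → IndepDom G S → ∣ S₀ ∣ ≤ ∣ S ∣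
  S₀-minimum S (S-independent , S-dominating) = ℕ.+-cancelʳ-≤ (X + in-cyc) ∣ S₀ ∣ ∣ S ∣ (begin
    ∣ S₀ ∣ + (X + in-cyc)        ≡⟨ sym (ℕ.+-assoc ∣ S₀ ∣ X in-cyc) ⟩
    (∣ S₀ ∣ + X) + in-cyc        ≡⟨ cong (_+ in-cyc) ∣S₀∣+∑picked*linkDeg ⟩
    (#picked + #links) + in-cyc  ≡⟨ ℕ.+-assoc #picked #links in-cyc ⟩
    #picked + (#links + in-cyc)  ≤⟨ ℕ.+-monoʳ-≤ #picked #links+in-cyc≤∣S∣+Y ⟩
    #picked + (∣ S ∣ + Y)        ≡⟨ swap-left #picked ∣ S ∣ Y ⟩
    ∣ S ∣ + (#picked + Y)        ≤⟨ ℕ.+-monoʳ-≤ ∣ S ∣ #picked+Y≤X+in-cyc ⟩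
    ∣ S ∣ + (X + in-cyc)         ∎)
    where
    open Against S S-independent S-dominating
    open ℕ.≤-Reasoning
    swap-left : ∀ a b c → a + (b + c) ≡ b + (a + c)
    swap-left = solve-∀

module Edgeless {n} (G : Graph n) (connected : Connected G) (no-edges : ∀ {u v} → ¬ Adj G u v) where

  n≡1 : n ≡ 1
  n≡1 with proj₁ connected
  ... | v = ≤1 (λ u → reach≡ (proj₂ connected u v)) v
    where
    reach≡ : ∀ {u v} → ReachIn G (Everything G) u v → u ≡ v
    reach≡ (here _)       = refl
    reach≡ (step _ uw _) = contradiction uw no-edges
    ≤1 : ∀ {m} {v : Fin m} → (∀ u → u ≡ v) → Fin m → m ≡ 1
    ≤1 {suc zero}    _      _ = refl
    ≤1 {suc (suc _)} all≡v _ with () ← trans (all≡v Fin.zero) (sym (all≡v (Fin.suc Fin.zero)))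

  ⊤-indepDom : IndepDom G ⊤
  ⊤-indepDom = (λ _ _ _ _ → no-edges) , (λ v v∉⊤ → contradiction Subset.∈⊤ v∉⊤)

  ⊤-minimum : ∀ S → IndepDom G S → ∣ ⊤ {n} ∣ ≤ ∣ S ∣
  ⊤-minimum S (_ , S-dominating) = Subset.p⊆q⇒∣p∣≤∣q∣ {p = ⊤} (λ {v} _ → in-S v)
    where
    in-S : ∀ v → v ∈ S
    in-S v with v Subset.∈? S
    ... | yes v∈S = v∈S
    ... | no  v∉S = let _ , _ , uv = S-dominating v v∉S in contradiction uv no-edges

¬¬-decidable : ∀ {n p} (P : Pred (Fin n) p) → ¬ ¬ Decidable P
¬¬-decidable {zero}  P k = k (λ ())
¬¬-decidable {suc n} P k = ¬¬-excluded-middle (λ d₀ → ¬¬-decidable (P ∘ Fin.suc) (λ ds → k (λ { Fin.zero → d₀ ; (Fin.suc v) → ds v })))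

allSubsets? : ∀ {n p} {P : Pred (Subset n) p} → Decidable P → Dec (∀ S → P S)
allSubsets? P? with Subset.anySubset? (¬? ∘ P?)
... | yes (S , ¬PS) = no (λ all → ¬PS (all S))
... | no  none      = yes (λ S → decidable-stable (P? S) (λ ¬PS → none (S , ¬PS)))

indepDom? : ∀ {n} (G : Graph n) → Decidable (IndepDom G)
indepDom? G S = Fin.all? (λ u → Fin.all? (λ v → (u Subset.∈? S) →-dec (v Subset.∈? S) →-dec ¬? (Adj? u v)))
          ×-dec Fin.all? (λ v → ¬? (v Subset.∈? S) →-dec Fin.any? (λ u → (u Subset.∈? S) ×-dec Adj? u v))
  where open GraphBasics G

module _ (Δ : ℕ) (4≤Δ : 4 ≤ Δ) {n} (G : Graph n) (special : Special G Δ) where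

  D Q : ℕ
  D = Δ * Δ / 4 + Δ
  Q = D ∸ Δ

  MinimumWitness : Set
  MinimumWitness = Σ (Subset n) λ S → (IndepDom G S × (∀ S′ → IndepDom G S′ → ∣ S ∣ ≤ ∣ S′ ∣)) × D * ∣ S ∣ ≡ Q * (n ∸ 1) + D

  minimumWitness? : Dec MinimumWitness
  minimumWitness? = Subset.anySubset? (λ S → (indepDom? G S ×-dec allSubsets? (λ S′ → indepDom? G S′ →-dec ∣ S ∣ ℕ.≤? ∣ S′ ∣))
                                              ×-dec D * ∣ S ∣ ℕ.≟ Q * (n ∸ 1) + D)

  minimumWitness-from : Decidable (OnCycle G) → MinimumWitness
  minimumWitness-from cyc? with Fin.any? cyc?
  ... | yes (r , r-cyc) = S₀ , ((S₀-independent , S₀-dominating) , S₀-minimum) , S₀-size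
    where open SpecialGraph Δ 4≤Δ G special cyc? r r-cyc
  ... | no  acyclic     = ⊤ , (⊤-indepDom , ⊤-minimum) , size
    where
    open Edgeless G (proj₁ special) (λ {u} {v} uv → [ (λ cu → acyclic (u , cu)) , (λ cv → acyclic (v , cv)) ]′ (proj₁ (proj₂ (proj₂ special)) u v uv))
    size : D * ∣ ⊤ {n} ∣ ≡ Q * (n ∸ 1) + D
    size = begin
      D * ∣ ⊤ {n} ∣       ≡⟨ cong (D *_) (trans (Subset.∣⊤∣≡n n) n≡1) ⟩
      D * 1               ≡⟨ ℕ.*-identityʳ D ⟩
      D                   ≡⟨ cong (_+ D) (sym (trans (cong (λ m → Q * (m ∸ 1)) n≡1) (ℕ.*-zeroʳ Q))) ⟩
      Q * (n ∸ 1) + D     ∎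
      where open ≡-Reasoning

  -- Whether a vertex lies on a cycle is not decidable as stated, but the existence of a minimum witness is,
  -- so it suffices to have that decision procedure up to double negation.
  minimumWitness : MinimumWitness
  minimumWitness = decidable-stable minimumWitness? (λ ¬w → ¬¬-decidable (OnCycle G) (¬w ∘ minimumWitness-from))

proposition3p1 : (Δ : ℕ) → 4 ≤ Δ → (n : ℕ) → (G : Graph n) → Special G Δ →
    ∃[ i ] (IsIndepDomNumber G i ×
      ((Δ * Δ / 4 + Δ) * i ≡ ((Δ * Δ / 4 + Δ) ∸ Δ) * (n ∸ 1) + (Δ * Δ / 4 + Δ)))
proposition3p1 Δ 4≤Δ n G special with minimumWitness Δ 4≤Δ G special
... | S , (S-indepDom , S-minimum) , size = ∣ S ∣ , ((S , S-indepDom , refl) , S-minimum) , size
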